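{- Let $G$ and $G'$ be finite graphs (loops and multiple edges allowed). If $\widehat{T}(G;x,y)=\widehat{T}(G';x,y)$ as polynomials, then $T(G;x,y)=T(G';x,y)$. That is, the Tutte polynomial $T(G)$ is determined by $\widehat{T}(G)$.
   Context: For $s\subseteq E(G)$, $[G:s]$ is the spanning subgraph with vertex set $V(G)$ and edge set $s$; $b_0(s)$ and $b_1(s)$ are the number of connected components and the first Betti number (cycle rank) of $[G:s]$. $\widehat{T}(G;x,y)=\sum_{s\subseteq E(G)}(-1)^{|s|}(1+x)^{b_0(s)}(1+y)^{b_1(s)}$. $T(G;x,y)$ is the Tutte polynomial, defined by: $T(G)=T(G-e)+T(G/e)$ if $e$ is neither a loop nor an isthmus; $T(G)=xT(G-e)$ if $e$ is an isthmus; $T(G)=yT(G/e)$ if $e$ is a loop; $T(G)=1$ if $G$ has no edges. -}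

module Defs where

open import Data.Nat as ℕ using (ℕ; zero; suc; _∸_; _<ᵇ_)
open import Data.Integer as ℤ using (ℤ; +_; -[1+_])
open import Data.Fin using (Fin; toℕ; punchOut; _≟_)
open import Data.List using (List; []; _∷_; _++_; map; length; filter; allFin; foldr)
open import Data.Bool.ListAction using (any)
open import Data.Product using (_×_; _,_)
open import Data.Bool using (Bool; true; false; _∨_; _∧_; not; if_then_else_)
open import Relation.Nullary using (yes; no; ⌊_⌋)
open import Relation.Binary.PropositionalEquality using (_≡_; _≢_; sym)

-- Bivariate polynomials over ℤ, represented by their coefficient
-- functions:  p i j  is the coefficient of  x^i y^j.
-- All polynomials built below have finite support, so equality of
-- coefficient functions is equality "as polynomials".

Poly : Set
Poly = ℕ → ℕ → ℤ

Σ≤ : ℕ → (ℕ → ℤ) → ℤ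
Σ≤ zero    f = f 0
Σ≤ (suc k) f = Σ≤ k f ℤ.+ f (suc k)

constP : ℤ → Poly
constP c zero zero = c
constP c _    _    = + 0

0P 1P X Y : Poly
0P _ _ = + 0
1P = constP (+ 1)
X (suc zero) zero = + 1
X _ _ = + 0
Y zero (suc zero) = + 1
Y _ _ = + 0

_+P_ : Poly → Poly → Poly
(p +P q) i j = p i j ℤ.+ q i j

_*P_ : Poly → Poly → Poly
(p *P q) i j = Σ≤ i λ a → Σ≤ j λ b → p a b ℤ.* q (i ∸ a) (j ∸ b)

_^P_ : Poly → ℕ → Poly
p ^P zero  = 1P
p ^P suc k = p *P (p ^P k)

sumP : List Poly → Poly
sumP = foldr _+P_ 0P

_≈P_ : Poly → Poly → Set
p ≈P q = ∀ i j → p i j ≡ q i j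

-- Loops are pairs (v , v); parallel edges are repeated
-- entries of the list (distinct list positions are distinct edges).

record Graph : Set where
  constructor graph
  field
    n     : ℕ
    edges : List (Fin n × Fin n)
open Graph public

Edges : ℕ → Set
Edges n = List (Fin n × Fin n)

-- conn k es u v : u and v are joined by a walk of length ≤ k in [Fin n : es]
conn : {n : ℕ} → ℕ → Edges n → Fin n → Fin n → Bool
conn zero    es u v = ⌊ u ≟ v ⌋
conn (suc k) es u v =
  conn k es u v ∨
  any (λ { (a , b) → (conn k es u a ∧ ⌊ b ≟ v ⌋) ∨ (conn k es u b ∧ ⌊ a ≟ v ⌋) }) es

connected : {n : ℕ} → Edges n → Fin n → Fin n → Bool
connected {n} es = conn n es

-- b₀ : number of connected components
-- (counted as the number of vertices that are the least vertex of their component)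
b₀ : {n : ℕ} → Edges n → ℕ
b₀ {n} es = length (filter (λ v → not (any (λ w → (toℕ w <ᵇ toℕ v) ∧ connected es w v) (allFin n)) ≟B) (allFin n))
  where
  open import Data.Bool using (T)
  open import Relation.Nullary using (Dec)
  _≟B : (b : Bool) → Dec (T b)
  true ≟B = yes _
  false ≟B = no (λ ())

b₁ : {n : ℕ} → Edges n → ℕ
b₁ {n} es = (length es ℕ.+ b₀ es) ∸ n

-- all edge subsets s ⊆ E(G) (as sublists; one per subset of list positions)
subsets : {A : Set} → List A → List (List A)
subsets []       = [] ∷ []
subsets (e ∷ es) = let r = subsets es in r ++ map (e ∷_) r

That : Graph → Poly
That G = sumP (map term (subsets (edges G)))
  where
  term : Edges (n G) → Poly
  term s = constP (-[1+ 0 ] ℤ.^ length s) *P (((1P +P X) ^P b₀ s) *P ((1P +P Y) ^P b₁ s))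

-- Contraction of a non-loop edge (u , v): v is identified with u and
-- removed from the vertex set.

contractV : {m : ℕ} (u v : Fin (suc m)) → u ≢ v → Fin (suc m) → Fin m
contractV u v u≢v w with w ≟ v
... | yes _   = punchOut {i = v} {j = u} (λ eq → u≢v (sym eq))
... | no w≢v  = punchOut {i = v} {j = w} (λ eq → w≢v (sym eq))

contractE : {m : ℕ} (u v : Fin (suc m)) → u ≢ v → Edges (suc m) → Edges m
contractE u v u≢v = map (λ { (a , b) → (contractV u v u≢v a , contractV u v u≢v b) })

-- Tutte polynomial by deletion–contraction, always on the first edge e = (u , v)
-- of the list; the remaining list es is the edge list of G - e.
-- The first argument is fuel (= number of edges).
tutteAux : ℕ → (n : ℕ) → Edges n → Poly
tutteAux _       n       []              = 1P
tutteAux zero    n       (_ ∷ _)         = 1P   -- unreachable with enough fuel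
tutteAux (suc k) zero    ((() , _) ∷ _)
tutteAux (suc k) (suc m) ((u , v) ∷ es) with u ≟ v
... | yes _   = Y *P tutteAux k (suc m) es
... | no u≢v  = if connected es u v
                then tutteAux k (suc m) es +P tutteAux k m (contractE u v u≢v es)
                else X *P tutteAux k (suc m) es

tutte : Graph → Poly
tutte G = tutteAux (length (edges G)) (n G) (edges G)

-- Let k(G) = b₀(G) and n = |V(G)|. Deletion–contraction for T̂ (a loop multiplies it by -y, any other
-- edge e gives T̂(G) = T̂(G - e) - T̂(G / e), and for an isthmus T̂(G - e) = (1 + x) T̂(G / e)) proves,
-- by induction along the recursion defining T, that
--   T̂(G; x, y) = (-1)^(n - k(G)) (1 + x)^k(G) T(G; -x, -y).
-- Since T has natural coefficients and is nonzero, T(G; -x, -y) does not vanish at x = -1, so k(G) is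
-- the exact power of 1 + x dividing T̂(G). Cancelling it from T̂(G) = T̂(G') leaves
-- T(G; -x, -y) = ±T(G'; -x, -y), and positivity of the coefficients forces the sign +.

module Submission where

open import Defs

open import Algebra.Bundles using (AbelianGroup)
open import Data.Bool using (Bool; true; false; _∨_; _∧_; not; T; if_then_else_)
open import Data.Bool.ListAction using (any)
import Data.Bool.Properties as BoolP
open import Data.Empty using (⊥; ⊥-elim)
open import Data.Fin as Fin using (Fin; toℕ; fromℕ; inject₁; _≟_; punchIn; punchOut)
import Data.Fin.Properties as FinP
open import Data.Fin.Relation.Unary.Top using (view; ‵fromℕ; ‵inj₁; view-fromℕ; view-inject₁)
open import Data.Integer as ℤ using (ℤ; +_; -[1+_]; _+_; _*_)
import Data.Integer.Properties as ℤP
open import Data.Integer.Solver using (module +-*-Solver)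
open import Data.List using (List; []; _∷_; _++_; map; filter; length; allFin; tabulate)
import Data.List.Properties as ListP
open import Data.List.Membership.Propositional using (_∈_)
open import Data.List.Membership.Propositional.Properties using (∈-map⁺; ∈-map⁻; ∈-++⁻)
open import Data.List.Relation.Unary.Any using (here; there)
open import Data.Nat as ℕ using (ℕ; zero; suc; _∸_; _≤_; _<_; z≤n; s≤s)
import Data.Nat.Properties as ℕP
open import Data.Product using (∃; _×_; _,_; proj₁; proj₂)
open import Data.Sum using (_⊎_; inj₁; inj₂)
open import Data.Unit using (tt)
open import Function using (_∘_; case_of_)
open import Relation.Binary.Bundles using (Setoid)
open import Relation.Binary.PropositionalEquality
import Relation.Binary.Reasoning.Setoid as SetoidReasoning
open import Relation.Binary.Structures using (IsEquivalence)
open import Relation.Nullary using (¬_; Dec; yes; no; ⌊_⌋)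

open import Algebra.Properties.CommutativeSemigroup ℤP.+-commutativeSemigroup
  using () renaming (interchange to +-interchange)
open import Algebra.Properties.CommutativeSemigroup ℤP.*-commutativeSemigroup
  using () renaming (interchange to *-interchange; x∙yz≈y∙xz to *-lcomm)
open import Algebra.Properties.Group (AbelianGroup.group ℤP.+-0-abelianGroup) using (∙-cancelʳ)

module ℤSolver = +-*-Solver

module FiniteSums where

  open ≡-Reasoning

  Σ≤-cong : ∀ k {f g : ℕ → ℤ} → (∀ a → a ≤ k → f a ≡ g a) → Σ≤ k f ≡ Σ≤ k g
  Σ≤-cong zero    f≡g = f≡g 0 z≤n
  Σ≤-cong (suc k) f≡g =
    cong₂ _+_ (Σ≤-cong k (λ a a≤k → f≡g a (ℕP.m≤n⇒m≤1+n a≤k))) (f≡g (suc k) ℕP.≤-refl)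

  Σ≤-+ : ∀ k (f g : ℕ → ℤ) → Σ≤ k (λ a → f a + g a) ≡ Σ≤ k f + Σ≤ k g
  Σ≤-+ zero    f g = refl
  Σ≤-+ (suc k) f g =
    trans (cong (_+ (f (suc k) + g (suc k))) (Σ≤-+ k f g)) (+-interchange (Σ≤ k f) (Σ≤ k g) _ _)

  *-distribˡ-Σ≤ : ∀ k c (f : ℕ → ℤ) → c * Σ≤ k f ≡ Σ≤ k (λ a → c * f a)
  *-distribˡ-Σ≤ zero    c f = refl
  *-distribˡ-Σ≤ (suc k) c f =
    trans (ℤP.*-distribˡ-+ c (Σ≤ k f) (f (suc k))) (cong (_+ c * f (suc k)) (*-distribˡ-Σ≤ k c f))

  *-distribʳ-Σ≤ : ∀ k c (f : ℕ → ℤ) → Σ≤ k f * c ≡ Σ≤ k (λ a → f a * c)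
  *-distribʳ-Σ≤ k c f =
    trans (ℤP.*-comm (Σ≤ k f) c)
      (trans (*-distribˡ-Σ≤ k c f) (Σ≤-cong k (λ a _ → ℤP.*-comm c (f a))))

  Σ≤-zero : ∀ k (f : ℕ → ℤ) → (∀ a → a ≤ k → f a ≡ + 0) → Σ≤ k f ≡ + 0
  Σ≤-zero k f f≡0 = trans (Σ≤-cong k f≡0) (Σ≤-const0 k)
    where
    Σ≤-const0 : ∀ k → Σ≤ k (λ _ → + 0) ≡ + 0
    Σ≤-const0 zero    = refl
    Σ≤-const0 (suc k) = cong (_+ + 0) (Σ≤-const0 k)

  Σ≤-swap : ∀ i j (f : ℕ → ℕ → ℤ) →
            Σ≤ i (λ a → Σ≤ j (f a)) ≡ Σ≤ j (λ b → Σ≤ i (λ a → f a b))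
  Σ≤-swap zero    j f = refl
  Σ≤-swap (suc i) j f =
    trans (cong (_+ Σ≤ j (f (suc i))) (Σ≤-swap i j f)) (sym (Σ≤-+ j _ _))

  Σ≤-suc : ∀ k (f : ℕ → ℤ) → Σ≤ (suc k) f ≡ f 0 + Σ≤ k (λ a → f (suc a))
  Σ≤-suc zero    f = refl
  Σ≤-suc (suc k) f =
    trans (cong (_+ f (suc (suc k))) (Σ≤-suc k f)) (ℤP.+-assoc (f 0) _ (f (suc (suc k))))

  Σ≤-reverse : ∀ k (f : ℕ → ℤ) → Σ≤ k f ≡ Σ≤ k (λ a → f (k ∸ a))
  Σ≤-reverse zero    f = refl
  Σ≤-reverse (suc k) f = begin
    Σ≤ k f + f (suc k)                    ≡⟨ cong (_+ f (suc k)) (Σ≤-reverse k f) ⟩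
    Σ≤ k (λ a → f (k ∸ a)) + f (suc k)    ≡⟨ ℤP.+-comm _ (f (suc k)) ⟩
    f (suc k) + Σ≤ k (λ a → f (k ∸ a))    ≡⟨ sym (Σ≤-suc k (λ a → f (suc k ∸ a))) ⟩
    Σ≤ (suc k) (λ a → f (suc k ∸ a))      ∎

  Σ≤-first : ∀ k (f : ℕ → ℤ) → (∀ a → f (suc a) ≡ + 0) → Σ≤ k f ≡ f 0
  Σ≤-first zero    f f≡0 = refl
  Σ≤-first (suc k) f f≡0 =
    trans (cong₂ _+_ (Σ≤-first k f f≡0) (f≡0 k)) (ℤP.+-identityʳ (f 0))

  Σ≤-triangle : ∀ i (g : ℕ → ℕ → ℤ) →
                Σ≤ i (λ a → Σ≤ a (g a)) ≡ Σ≤ i (λ b → Σ≤ (i ∸ b) (λ c → g (b ℕ.+ c) b))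
  Σ≤-triangle zero    g = refl
  Σ≤-triangle (suc i) g = begin
    Σ≤ i (λ a → Σ≤ a (g a)) + (Σ≤ i (g (suc i)) + g (suc i) (suc i))
      ≡⟨ cong (_+ (Σ≤ i (g (suc i)) + g (suc i) (suc i))) (Σ≤-triangle i g) ⟩
    Σ≤ i h + (Σ≤ i (g (suc i)) + g (suc i) (suc i))
      ≡⟨ sym (ℤP.+-assoc (Σ≤ i h) _ _) ⟩
    (Σ≤ i h + Σ≤ i (g (suc i))) + g (suc i) (suc i)
      ≡⟨ cong (_+ g (suc i) (suc i)) (sym (Σ≤-+ i _ _)) ⟩
    Σ≤ i (λ b → h b + g (suc i) b) + g (suc i) (suc i)
      ≡⟨ cong₂ _+_ (Σ≤-cong i extend-row) (sym (diagonal)) ⟩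
    Σ≤ (suc i) (λ b → Σ≤ (suc i ∸ b) (λ c → g (b ℕ.+ c) b)) ∎
    where
    h : ℕ → ℤ
    h b = Σ≤ (i ∸ b) (λ c → g (b ℕ.+ c) b)
    extend-row : ∀ b → b ≤ i → h b + g (suc i) b ≡ Σ≤ (suc i ∸ b) (λ c → g (b ℕ.+ c) b)
    extend-row b b≤i
      rewrite ℕP.+-∸-assoc 1 b≤i
            | ℕP.+-suc b (i ∸ b)
            | ℕP.m+[n∸m]≡n b≤i = refl
    diagonal : Σ≤ (suc i ∸ suc i) (λ c → g (suc i ℕ.+ c) (suc i)) ≡ g (suc i) (suc i)
    diagonal rewrite ℕP.n∸n≡0 i | ℕP.+-identityʳ i = refl

module Polynomials where

  open FiniteSums

  ≈P-isEquivalence : IsEquivalence _≈P_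
  ≈P-isEquivalence = record
    { refl  = λ i j → refl
    ; sym   = λ p≈q i j → sym (p≈q i j)
    ; trans = λ p≈q q≈r i j → trans (p≈q i j) (q≈r i j)
    }

  ≈P-setoid : Setoid _ _
  ≈P-setoid = record { isEquivalence = ≈P-isEquivalence }

  open IsEquivalence ≈P-isEquivalence public
    renaming (refl to ≈P-refl; sym to ≈P-sym; trans to ≈P-trans; reflexive to ≡⇒≈P)
  module ≈P-Reasoning = SetoidReasoning ≈P-setoid

  +P-cong : ∀ {p p′ q q′} → p ≈P p′ → q ≈P q′ → (p +P q) ≈P (p′ +P q′)
  +P-cong p≈ q≈ i j = cong₂ _+_ (p≈ i j) (q≈ i j)

  *P-cong : ∀ {p p′ q q′} → p ≈P p′ → q ≈P q′ → (p *P q) ≈P (p′ *P q′)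
  *P-cong p≈ q≈ i j =
    Σ≤-cong i λ a _ → Σ≤-cong j λ b _ → cong₂ _*_ (p≈ a b) (q≈ (i ∸ a) (j ∸ b))

  *P-congˡ : ∀ p {q q′} → q ≈P q′ → (p *P q) ≈P (p *P q′)
  *P-congˡ p = *P-cong {p} ≈P-refl

  +P-assoc : ∀ p q r → ((p +P q) +P r) ≈P (p +P (q +P r))
  +P-assoc p q r i j = ℤP.+-assoc (p i j) (q i j) (r i j)

  +P-identityˡ : ∀ p → (0P +P p) ≈P p
  +P-identityˡ p i j = ℤP.+-identityˡ (p i j)

  +P-identityʳ : ∀ p → (p +P 0P) ≈P p
  +P-identityʳ p i j = ℤP.+-identityʳ (p i j)

  *P-comm : ∀ p q → (p *P q) ≈P (q *P p)
  *P-comm p q i j = begin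
    Σ≤ i (λ a → Σ≤ j (λ b → p a b * q (i ∸ a) (j ∸ b)))
      ≡⟨ Σ≤-reverse i _ ⟩
    Σ≤ i (λ a → Σ≤ j (λ b → p (i ∸ a) b * q (i ∸ (i ∸ a)) (j ∸ b)))
      ≡⟨ Σ≤-cong i (λ a _ → Σ≤-reverse j _) ⟩
    Σ≤ i (λ a → Σ≤ j (λ b → p (i ∸ a) (j ∸ b) * q (i ∸ (i ∸ a)) (j ∸ (j ∸ b))))
      ≡⟨ Σ≤-cong i (λ a a≤i → Σ≤-cong j λ b b≤j → swap-factors a b a≤i b≤j) ⟩
    Σ≤ i (λ a → Σ≤ j (λ b → q a b * p (i ∸ a) (j ∸ b))) ∎
    where
    open ≡-Reasoning
    swap-factors : ∀ a b → a ≤ i → b ≤ j →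
      p (i ∸ a) (j ∸ b) * q (i ∸ (i ∸ a)) (j ∸ (j ∸ b)) ≡ q a b * p (i ∸ a) (j ∸ b)
    swap-factors a b a≤i b≤j rewrite ℕP.m∸[m∸n]≡n a≤i | ℕP.m∸[m∸n]≡n b≤j =
      ℤP.*-comm (p (i ∸ a) (j ∸ b)) (q a b)

  *P-distribˡ-+P : ∀ p q r → (p *P (q +P r)) ≈P ((p *P q) +P (p *P r))
  *P-distribˡ-+P p q r i j =
    trans (Σ≤-cong i λ a _ →
             trans (Σ≤-cong j λ b _ → ℤP.*-distribˡ-+ (p a b) (q (i ∸ a) (j ∸ b)) (r (i ∸ a) (j ∸ b)))
                   (Σ≤-+ j _ _))
          (Σ≤-+ i _ _)

  *P-distribʳ-+P : ∀ p q r → ((q +P r) *P p) ≈P ((q *P p) +P (r *P p))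
  *P-distribʳ-+P p q r = begin
    (q +P r) *P p          ≈⟨ *P-comm (q +P r) p ⟩
    p *P (q +P r)          ≈⟨ *P-distribˡ-+P p q r ⟩
    (p *P q) +P (p *P r)   ≈⟨ +P-cong (*P-comm p q) (*P-comm p r) ⟩
    (q *P p) +P (r *P p)   ∎
    where open ≈P-Reasoning

  *P-zeroʳ : ∀ p → (p *P 0P) ≈P 0P
  *P-zeroʳ p i j = Σ≤-zero i _ (λ a _ → Σ≤-zero j _ (λ b _ → ℤP.*-zeroʳ (p a b)))

  *P-assoc : ∀ p q r → ((p *P q) *P r) ≈P (p *P (q *P r))
  *P-assoc p q r i j = begin
    Σ≤ i (λ a → Σ≤ j (λ b → Σ≤ a (λ a′ → Σ≤ b (λ b′ → p a′ b′ * q (a ∸ a′) (b ∸ b′))) * r (i ∸ a) (j ∸ b)))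
      ≡⟨ Σ≤-cong i (λ a _ → Σ≤-cong j λ b _ →
           trans (*-distribʳ-Σ≤ a _ _) (Σ≤-cong a λ a′ _ → *-distribʳ-Σ≤ b _ _)) ⟩
    Σ≤ i (λ a → Σ≤ j (λ b → Σ≤ a (λ a′ → Σ≤ b (λ b′ → F a a′ b b′))))
      ≡⟨ Σ≤-cong i (λ a _ → Σ≤-swap j a _) ⟩
    Σ≤ i (λ a → Σ≤ a (λ a′ → Σ≤ j (λ b → Σ≤ b (λ b′ → F a a′ b b′))))
      ≡⟨ Σ≤-cong i (λ a _ → Σ≤-cong a λ a′ _ → Σ≤-triangle j _) ⟩
    Σ≤ i (λ a → Σ≤ a (λ a′ → Σ≤ j (λ b′ → Σ≤ (j ∸ b′) (λ d → F a a′ (b′ ℕ.+ d) b′))))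
      ≡⟨ Σ≤-triangle i _ ⟩
    Σ≤ i (λ a′ → Σ≤ (i ∸ a′) (λ c → Σ≤ j (λ b′ → Σ≤ (j ∸ b′) (λ d → F (a′ ℕ.+ c) a′ (b′ ℕ.+ d) b′))))
      ≡⟨ Σ≤-cong i (λ a′ _ → Σ≤-swap (i ∸ a′) j _) ⟩
    Σ≤ i (λ a′ → Σ≤ j (λ b′ → Σ≤ (i ∸ a′) (λ c → Σ≤ (j ∸ b′) (λ d → F (a′ ℕ.+ c) a′ (b′ ℕ.+ d) b′))))
      ≡⟨ Σ≤-cong i (λ a′ _ → Σ≤-cong j λ b′ _ → factor-out a′ b′) ⟩
    Σ≤ i (λ a′ → Σ≤ j (λ b′ → p a′ b′ * Σ≤ (i ∸ a′) (λ c → Σ≤ (j ∸ b′) (λ d → q c d * r (i ∸ a′ ∸ c) (j ∸ b′ ∸ d))))) ∎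
    where
    open ≡-Reasoning
    F : ℕ → ℕ → ℕ → ℕ → ℤ
    F a a′ b b′ = (p a′ b′ * q (a ∸ a′) (b ∸ b′)) * r (i ∸ a) (j ∸ b)
    regroup : ∀ a′ b′ c d → F (a′ ℕ.+ c) a′ (b′ ℕ.+ d) b′ ≡ p a′ b′ * (q c d * r (i ∸ a′ ∸ c) (j ∸ b′ ∸ d))
    regroup a′ b′ c d
      rewrite ℕP.m+n∸m≡n a′ c | ℕP.m+n∸m≡n b′ d | ℕP.∸-+-assoc i a′ c | ℕP.∸-+-assoc j b′ d =
      ℤP.*-assoc (p a′ b′) (q c d) (r (i ∸ (a′ ℕ.+ c)) (j ∸ (b′ ℕ.+ d)))
    factor-out : ∀ a′ b′ →
      Σ≤ (i ∸ a′) (λ c → Σ≤ (j ∸ b′) (λ d → F (a′ ℕ.+ c) a′ (b′ ℕ.+ d) b′)) ≡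
      p a′ b′ * Σ≤ (i ∸ a′) (λ c → Σ≤ (j ∸ b′) (λ d → q c d * r (i ∸ a′ ∸ c) (j ∸ b′ ∸ d)))
    factor-out a′ b′ =
      trans (Σ≤-cong (i ∸ a′) λ c _ →
               trans (Σ≤-cong (j ∸ b′) λ d _ → regroup a′ b′ c d) (sym (*-distribˡ-Σ≤ (j ∸ b′) (p a′ b′) _)))
            (sym (*-distribˡ-Σ≤ (i ∸ a′) (p a′ b′) _))

  *P-lcomm : ∀ p q r → (p *P (q *P r)) ≈P (q *P (p *P r))
  *P-lcomm p q r = begin
    p *P (q *P r)   ≈⟨ ≈P-sym (*P-assoc p q r) ⟩
    (p *P q) *P r   ≈⟨ *P-cong (*P-comm p q) (≈P-refl {r}) ⟩
    (q *P p) *P r   ≈⟨ *P-assoc q p r ⟩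
    q *P (p *P r)   ∎
    where open ≈P-Reasoning

  infixr 25 _·_

  _·_ : ℤ → Poly → Poly
  (c · p) i j = c * p i j

  ·-congʳ : ∀ c {p q} → p ≈P q → (c · p) ≈P (c · q)
  ·-congʳ c p≈q i j = cong (c *_) (p≈q i j)

  ·-assoc : ∀ c d p → (c · d · p) ≈P ((c * d) · p)
  ·-assoc c d p i j = sym (ℤP.*-assoc c d (p i j))

  ·-comm : ∀ c d p → (c · d · p) ≈P (d · c · p)
  ·-comm c d p i j = *-lcomm c d (p i j)

  ·-identityˡ : ∀ p → ((+ 1) · p) ≈P p
  ·-identityˡ p i j = ℤP.*-identityˡ (p i j)

  ·-distrib-+P : ∀ c p q → (c · (p +P q)) ≈P ((c · p) +P (c · q))
  ·-distrib-+P c p q i j = ℤP.*-distribˡ-+ c (p i j) (q i j)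

  ·-*P-assoc : ∀ c p q → ((c · p) *P q) ≈P (c · (p *P q))
  ·-*P-assoc c p q i j =
    sym (trans (*-distribˡ-Σ≤ i c _)
               (Σ≤-cong i λ a _ → trans (*-distribˡ-Σ≤ j c _)
                                        (Σ≤-cong j λ b _ → sym (ℤP.*-assoc c (p a b) _))))

  *P-·-comm : ∀ c p q → (p *P (c · q)) ≈P (c · (p *P q))
  *P-·-comm c p q = begin
    p *P (c · q)    ≈⟨ *P-comm p (c · q) ⟩
    (c · q) *P p    ≈⟨ ·-*P-assoc c q p ⟩
    c · (q *P p)    ≈⟨ ·-congʳ c (*P-comm q p) ⟩
    c · (p *P q)    ∎
    where open ≈P-Reasoning

  constP-*P : ∀ c p → (constP c *P p) ≈P (c · p)
  constP-*P c p i j = begin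
    Σ≤ i (λ a → Σ≤ j (λ b → constP c a b * p (i ∸ a) (j ∸ b)))
      ≡⟨ Σ≤-first i _ (λ a → Σ≤-zero j _ (λ b _ → refl)) ⟩
    Σ≤ j (λ b → constP c 0 b * p i (j ∸ b))
      ≡⟨ Σ≤-first j _ (λ b → refl) ⟩
    c * p i j ∎
    where open ≡-Reasoning

  *P-identityˡ : ∀ p → (1P *P p) ≈P p
  *P-identityˡ p = ≈P-trans (constP-*P (+ 1) p) (·-identityˡ p)

  shiftX shiftY : Poly → Poly
  shiftX p zero    j = + 0
  shiftX p (suc i) j = p i j
  shiftY p i zero    = + 0
  shiftY p i (suc j) = p i j

  X*P≈shiftX : ∀ p → (X *P p) ≈P shiftX p
  X*P≈shiftX p zero    j = Σ≤-zero j _ (λ { zero _ → refl ; (suc b) _ → refl })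
  X*P≈shiftX p (suc i) j = begin
    Σ≤ (suc i) (λ a → Σ≤ j (λ b → X a b * p (suc i ∸ a) (j ∸ b)))
      ≡⟨ Σ≤-suc i _ ⟩
    Σ≤ j (λ b → X 0 b * p (suc i) (j ∸ b)) + Σ≤ i (λ a → Σ≤ j (λ b → X (suc a) b * p (i ∸ a) (j ∸ b)))
      ≡⟨ cong₂ _+_ (Σ≤-zero j _ (λ { zero _ → refl ; (suc b) _ → refl }))
                   (Σ≤-first i _ (λ a → Σ≤-zero j _ (λ { zero _ → refl ; (suc b) _ → refl }))) ⟩
    + 0 + Σ≤ j (λ b → X 1 b * p i (j ∸ b))
      ≡⟨ ℤP.+-identityˡ _ ⟩
    Σ≤ j (λ b → X 1 b * p i (j ∸ b))
      ≡⟨ Σ≤-first j _ (λ b → refl) ⟩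
    + 1 * p i j
      ≡⟨ ℤP.*-identityˡ (p i j) ⟩
    p i j ∎
    where open ≡-Reasoning

  Y*P≈shiftY : ∀ p → (Y *P p) ≈P shiftY p
  Y*P≈shiftY p i zero    = Σ≤-zero i _ (λ { zero _ → refl ; (suc a) _ → refl })
  Y*P≈shiftY p i (suc j) = begin
    Σ≤ i (λ a → Σ≤ (suc j) (λ b → Y a b * p (i ∸ a) (suc j ∸ b)))
      ≡⟨ Σ≤-first i _ (λ a → Σ≤-zero (suc j) _ (λ { zero _ → refl ; (suc b) _ → refl })) ⟩
    Σ≤ (suc j) (λ b → Y 0 b * p i (suc j ∸ b))
      ≡⟨ Σ≤-suc j _ ⟩
    + 0 + Σ≤ j (λ b → Y 0 (suc b) * p i (j ∸ b))
      ≡⟨ ℤP.+-identityˡ _ ⟩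
    Σ≤ j (λ b → Y 0 (suc b) * p i (j ∸ b))
      ≡⟨ Σ≤-first j _ (λ b → refl) ⟩
    + 1 * p i j
      ≡⟨ ℤP.*-identityˡ (p i j) ⟩
    p i j ∎
    where open ≡-Reasoning

  1+Z*P : ∀ z p → ((1P +P z) *P p) ≈P (p +P (z *P p))
  1+Z*P z p = ≈P-trans (*P-distribʳ-+P p 1P z) (+P-cong (*P-identityˡ p) (≈P-refl {z *P p}))

  ^P-+ : ∀ p a b → (p ^P (a ℕ.+ b)) ≈P ((p ^P a) *P (p ^P b))
  ^P-+ p zero    b = ≈P-sym (*P-identityˡ (p ^P b))
  ^P-+ p (suc a) b = ≈P-trans (*P-congˡ p (^P-+ p a b)) (≈P-sym (*P-assoc p (p ^P a) (p ^P b)))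

  1+X*P-cancel : ∀ p q → ((1P +P X) *P p) ≈P ((1P +P X) *P q) → p ≈P q
  1+X*P-cancel p q eq = telescope (≈P-trans (≈P-sym (expand p)) (≈P-trans eq (expand q)))
    where
    expand : ∀ r → ((1P +P X) *P r) ≈P (r +P shiftX r)
    expand r = ≈P-trans (1+Z*P X r) (+P-cong (≈P-refl {r}) (X*P≈shiftX r))
    telescope : (p +P shiftX p) ≈P (q +P shiftX q) → p ≈P q
    telescope h zero    j = trans (sym (ℤP.+-identityʳ (p 0 j))) (trans (h 0 j) (ℤP.+-identityʳ (q 0 j)))
    telescope h (suc i) j =
      ∙-cancelʳ (p i j) (p (suc i) j) (q (suc i) j)
        (trans (h (suc i) j) (cong (λ z → q (suc i) j + z) (sym (telescope h i j))))

  [1+X]^*P-cancel : ∀ k p q → (((1P +P X) ^P k) *P p) ≈P (((1P +P X) ^P k) *P q) → p ≈P q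
  [1+X]^*P-cancel zero    p q eq =
    ≈P-trans (≈P-sym (*P-identityˡ p)) (≈P-trans eq (*P-identityˡ q))
  [1+X]^*P-cancel (suc k) p q eq =
    [1+X]^*P-cancel k p q (1+X*P-cancel (((1P +P X) ^P k) *P p) (((1P +P X) ^P k) *P q)
      (≈P-trans (≈P-sym (*P-assoc (1P +P X) ((1P +P X) ^P k) p))
        (≈P-trans eq (*P-assoc (1P +P X) ((1P +P X) ^P k) q))))

module Signs where

  open Polynomials

  sign : ℕ → ℤ
  sign k = -[1+ 0 ] ℤ.^ k

  sign-+ : ∀ a b → sign (a ℕ.+ b) ≡ sign a * sign b
  sign-+ = ℤP.^-distribˡ-+-* -[1+ 0 ]

  sign-square : ∀ a → sign a * sign a ≡ + 1
  sign-square zero    = refl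
  sign-square (suc a) = trans (square-neg (sign a)) (sign-square a)
    where
    square-neg : ∀ x → (ℤ.-1ℤ * x) * (ℤ.-1ℤ * x) ≡ x * x
    square-neg = solve 1 (λ x → (con ℤ.-1ℤ :* x) :* (con ℤ.-1ℤ :* x) := x :* x) refl
      where open ℤSolver

  sign-cancelˡ : ∀ a x → sign a * (sign a * x) ≡ x
  sign-cancelˡ a x =
    trans (sym (ℤP.*-assoc (sign a) (sign a) x)) (trans (cong (_* x) (sign-square a)) (ℤP.*-identityˡ x))

  sign≡1⊎sign≡-1 : ∀ a → sign a ≡ + 1 ⊎ sign a ≡ ℤ.-1ℤ
  sign≡1⊎sign≡-1 zero    = inj₁ refl
  sign≡1⊎sign≡-1 (suc a) with sign≡1⊎sign≡-1 a
  ... | inj₁ eq = inj₂ (cong (ℤ.-1ℤ *_) eq)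
  ... | inj₂ eq = inj₁ (cong (ℤ.-1ℤ *_) eq)

  sign*x≡0⇒x≡0 : ∀ a x → sign a * x ≡ + 0 → x ≡ + 0
  sign*x≡0⇒x≡0 a x eq = trans (sym (sign-cancelˡ a x)) (trans (cong (sign a *_) eq) (ℤP.*-zeroʳ (sign a)))

  ·-sign-transpose : ∀ a b {p q} → (sign a · p) ≈P (sign b · q) → p ≈P (sign (a ℕ.+ b) · q)
  ·-sign-transpose a b {p} {q} eq i j = begin
    p i j                            ≡⟨ sym (sign-cancelˡ a (p i j)) ⟩
    sign a * (sign a * p i j)        ≡⟨ cong (sign a *_) (eq i j) ⟩
    sign a * (sign b * q i j)        ≡⟨ sym (ℤP.*-assoc (sign a) (sign b) (q i j)) ⟩
    (sign a * sign b) * q i j        ≡⟨ cong (_* q i j) (sym (sign-+ a b)) ⟩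
    sign (a ℕ.+ b) * q i j           ∎
    where open ≡-Reasoning

module NegatedVariables where

  open FiniteSums
  open Polynomials
  open Signs

  negVars : Poly → Poly
  negVars p i j = sign (i ℕ.+ j) * p i j

  negVars-cong : ∀ {p q} → p ≈P q → negVars p ≈P negVars q
  negVars-cong p≈q i j = cong (sign (i ℕ.+ j) *_) (p≈q i j)

  negVars-involutive : ∀ p → negVars (negVars p) ≈P p
  negVars-involutive p i j = sign-cancelˡ (i ℕ.+ j) (p i j)

  negVars-+P : ∀ p q → negVars (p +P q) ≈P (negVars p +P negVars q)
  negVars-+P p q i j = ℤP.*-distribˡ-+ (sign (i ℕ.+ j)) (p i j) (q i j)

  negVars-· : ∀ c p → negVars (c · p) ≈P (c · negVars p)
  negVars-· c p i j = *-lcomm (sign (i ℕ.+ j)) c (p i j)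

  negVars-1P : negVars 1P ≈P 1P
  negVars-1P zero    zero    = refl
  negVars-1P zero    (suc j) = ℤP.*-zeroʳ (sign (suc j))
  negVars-1P (suc i) j       = ℤP.*-zeroʳ (sign (suc i ℕ.+ j))

  negVars-X : negVars X ≈P (ℤ.-1ℤ · X)
  negVars-X zero          zero    = refl
  negVars-X zero          (suc j) = ℤP.*-zeroʳ (sign (suc j))
  negVars-X (suc zero)    zero    = refl
  negVars-X (suc zero)    (suc j) = ℤP.*-zeroʳ (sign (suc (suc j)))
  negVars-X (suc (suc i)) j       = ℤP.*-zeroʳ (sign (suc (suc i) ℕ.+ j))

  negVars-Y : negVars Y ≈P (ℤ.-1ℤ · Y)
  negVars-Y zero    zero          = refl
  negVars-Y zero    (suc zero)    = refl
  negVars-Y zero    (suc (suc j)) = ℤP.*-zeroʳ (sign (suc (suc j)))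
  negVars-Y (suc i) zero          = ℤP.*-zeroʳ (sign (suc i ℕ.+ 0))
  negVars-Y (suc i) (suc j)       = ℤP.*-zeroʳ (sign (suc i ℕ.+ suc j))

  negVars-*P : ∀ p q → negVars (p *P q) ≈P (negVars p *P negVars q)
  negVars-*P p q i j =
    trans (*-distribˡ-Σ≤ i (sign (i ℕ.+ j)) _)
      (Σ≤-cong i λ a a≤i → trans (*-distribˡ-Σ≤ j (sign (i ℕ.+ j)) _)
        (Σ≤-cong j λ b b≤j → split-sign a b a≤i b≤j))
    where
    degrees : ∀ a b → a ≤ i → b ≤ j → (a ℕ.+ b) ℕ.+ ((i ∸ a) ℕ.+ (j ∸ b)) ≡ i ℕ.+ j
    degrees a b a≤i b≤j = begin
      (a ℕ.+ b) ℕ.+ ((i ∸ a) ℕ.+ (j ∸ b))   ≡⟨ ℕP.+-assoc a b _ ⟩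
      a ℕ.+ (b ℕ.+ ((i ∸ a) ℕ.+ (j ∸ b)))   ≡⟨ cong (a ℕ.+_) (ℕP.+-comm b _) ⟩
      a ℕ.+ (((i ∸ a) ℕ.+ (j ∸ b)) ℕ.+ b)   ≡⟨ cong (a ℕ.+_) (ℕP.+-assoc (i ∸ a) (j ∸ b) b) ⟩
      a ℕ.+ ((i ∸ a) ℕ.+ ((j ∸ b) ℕ.+ b))   ≡⟨ sym (ℕP.+-assoc a (i ∸ a) _) ⟩
      (a ℕ.+ (i ∸ a)) ℕ.+ ((j ∸ b) ℕ.+ b)   ≡⟨ cong₂ ℕ._+_ (ℕP.m+[n∸m]≡n a≤i) (ℕP.m∸n+n≡m b≤j) ⟩
      i ℕ.+ j                               ∎
      where open ≡-Reasoning
    split-sign : ∀ a b → a ≤ i → b ≤ j →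
      sign (i ℕ.+ j) * (p a b * q (i ∸ a) (j ∸ b)) ≡
      (sign (a ℕ.+ b) * p a b) * (sign ((i ∸ a) ℕ.+ (j ∸ b)) * q (i ∸ a) (j ∸ b))
    split-sign a b a≤i b≤j
      rewrite sym (degrees a b a≤i b≤j) | sign-+ (a ℕ.+ b) ((i ∸ a) ℕ.+ (j ∸ b)) =
      *-interchange (sign (a ℕ.+ b)) _ (p a b) _

  negVars-·-*P : ∀ c z p → negVars z ≈P (c · z) → negVars (z *P p) ≈P (c · (z *P negVars p))
  negVars-·-*P c z p negVars-z = begin
    negVars (z *P p)            ≈⟨ negVars-*P z p ⟩
    negVars z *P negVars p      ≈⟨ *P-cong negVars-z (≈P-refl {negVars p}) ⟩
    (c · z) *P negVars p        ≈⟨ ·-*P-assoc c z (negVars p) ⟩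
    c · (z *P negVars p)        ∎
    where open ≈P-Reasoning

module EvaluationAtMinusOne where

  open FiniteSums
  open Polynomials
  open Signs
  open NegatedVariables

  DegX≤ : ℕ → Poly → Set
  DegX≤ B p = ∀ i j → B < i → p i j ≡ + 0

  DegX≤-*P : ∀ {B C p q} → DegX≤ B p → DegX≤ C q → DegX≤ (B ℕ.+ C) (p *P q)
  DegX≤-*P {B} {C} {p} {q} p-deg q-deg i j B+C<i = Σ≤-zero i _ (λ a a≤i → Σ≤-zero j _ (λ b _ → term-zero a b a≤i))
    where
    term-zero : ∀ a b → a ≤ i → p a b * q (i ∸ a) (j ∸ b) ≡ + 0
    term-zero a b a≤i with ℕP.≤-<-connex a B
    ... | inj₂ B<a = cong (_* q (i ∸ a) (j ∸ b)) (p-deg a b B<a)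
    ... | inj₁ a≤B = trans (cong (p a b *_) (q-deg (i ∸ a) (j ∸ b) C<i∸a)) (ℤP.*-zeroʳ (p a b))
      where
      C<i∸a : C < i ∸ a
      C<i∸a = ℕP.+-cancelˡ-< a C (i ∸ a)
        (subst (a ℕ.+ C <_) (sym (ℕP.m+[n∸m]≡n a≤i)) (ℕP.≤-<-trans (ℕP.+-monoˡ-≤ C a≤B) B+C<i))

  DegX≤-[1+X]^ : ∀ d → DegX≤ d ((1P +P X) ^P d)
  DegX≤-[1+X]^ zero    (suc i) j _ = refl
  DegX≤-[1+X]^ (suc d) = DegX≤-*P {1} {d} {1P +P X} degree-one (DegX≤-[1+X]^ d)
    where
    degree-one : DegX≤ 1 (1P +P X)
    degree-one (suc zero)    j (s≤s ())
    degree-one (suc (suc i)) j _ = refl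

  DegX≤-negVars : ∀ {B p} → DegX≤ B p → DegX≤ B (negVars p)
  DegX≤-negVars p-deg i j B<i = trans (cong (sign (i ℕ.+ j) *_) (p-deg i j B<i)) (ℤP.*-zeroʳ (sign (i ℕ.+ j)))

  atX=-1 : ℕ → Poly → ℕ → ℤ
  atX=-1 K p j = Σ≤ K (λ i → sign i * p i j)

  atX=-1-cong : ∀ K {p q} → p ≈P q → ∀ j → atX=-1 K p j ≡ atX=-1 K q j
  atX=-1-cong K p≈q j = Σ≤-cong K (λ i _ → cong (sign i *_) (p≈q i j))

  atX=-1-· : ∀ K c p j → atX=-1 K (c · p) j ≡ c * atX=-1 K p j
  atX=-1-· K c p j = trans (Σ≤-cong K (λ i _ → *-lcomm (sign i) c (p i j))) (sym (*-distribˡ-Σ≤ K c _))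

  atX=-1-telescope : ∀ K W j → atX=-1 K (W +P shiftX W) j ≡ sign K * W K j
  atX=-1-telescope zero    W j = cong (+ 1 *_) (ℤP.+-identityʳ (W 0 j))
  atX=-1-telescope (suc K) W j =
    trans (cong (_+ (sign (suc K) * (W (suc K) j + W K j))) (atX=-1-telescope K W j))
          (cancel (sign K) (W K j) (W (suc K) j))
    where
    open ℤSolver
    cancel : ∀ s a b → s * a + (ℤ.-1ℤ * s) * (b + a) ≡ (ℤ.-1ℤ * s) * b
    cancel = solve 3 (λ s a b → s :* a :+ (con ℤ.-1ℤ :* s) :* (b :+ a) := (con ℤ.-1ℤ :* s) :* b) refl

  atX=-1-[1+X]*P : ∀ {B} K W j → DegX≤ B W → B < K → atX=-1 K ((1P +P X) *P W) j ≡ + 0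
  atX=-1-[1+X]*P K W j W-deg B<K = begin
    atX=-1 K ((1P +P X) *P W) j    ≡⟨ atX=-1-cong K (≈P-trans (1+Z*P X W) (+P-cong (≈P-refl {W}) (X*P≈shiftX W))) j ⟩
    atX=-1 K (W +P shiftX W) j     ≡⟨ atX=-1-telescope K W j ⟩
    sign K * W K j                 ≡⟨ cong (sign K *_) (W-deg K j B<K) ⟩
    sign K * + 0                   ≡⟨ ℤP.*-zeroʳ (sign K) ⟩
    + 0                            ∎
    where open ≡-Reasoning

  atX=-1-negVars : ∀ K p j → atX=-1 K (negVars p) j ≡ sign j * Σ≤ K (λ i → p i j)
  atX=-1-negVars K p j = trans (Σ≤-cong K (λ i _ → sign-cancel i)) (sym (*-distribˡ-Σ≤ K (sign j) _))
    where
    sign-cancel : ∀ i → sign i * (sign (i ℕ.+ j) * p i j) ≡ sign j * p i j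
    sign-cancel i = begin
      sign i * (sign (i ℕ.+ j) * p i j)     ≡⟨ cong (λ s → sign i * (s * p i j)) (sign-+ i j) ⟩
      sign i * ((sign i * sign j) * p i j)  ≡⟨ cong (sign i *_) (ℤP.*-assoc (sign i) (sign j) (p i j)) ⟩
      sign i * (sign i * (sign j * p i j))  ≡⟨ sign-cancelˡ i _ ⟩
      sign j * p i j                        ∎
      where open ≡-Reasoning

module Twisting where

  open Polynomials
  open Signs
  open NegatedVariables

  twist : ℕ → ℕ → Poly → Poly
  twist e k T = sign e · (((1P +P X) ^P k) *P negVars T)

  twist-suc : ∀ e k T → twist (suc e) k T ≈P (ℤ.-1ℤ · twist e k T)
  twist-suc e k T = ≈P-sym (·-assoc ℤ.-1ℤ (sign e) (((1P +P X) ^P k) *P negVars T))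

  twist-+P : ∀ e k T₁ T₂ → twist e k (T₁ +P T₂) ≈P (twist e k T₁ +P twist e k T₂)
  twist-+P e k T₁ T₂ = begin
    sign e · (P^k *P negVars (T₁ +P T₂))                    ≈⟨ ·-congʳ (sign e) (*P-congˡ P^k (negVars-+P T₁ T₂)) ⟩
    sign e · (P^k *P (negVars T₁ +P negVars T₂))            ≈⟨ ·-congʳ (sign e) (*P-distribˡ-+P P^k (negVars T₁) (negVars T₂)) ⟩
    sign e · ((P^k *P negVars T₁) +P (P^k *P negVars T₂))   ≈⟨ ·-distrib-+P (sign e) _ _ ⟩
    twist e k T₁ +P twist e k T₂                            ∎
    where
    open ≈P-Reasoning
    P^k = (1P +P X) ^P k

  twist-*P : ∀ e k c Z T → negVars Z ≈P (c · Z) → twist e k (Z *P T) ≈P (c · (Z *P twist e k T))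
  twist-*P e k c Z T negVars-Z = begin
    sign e · (P^k *P negVars (Z *P T))        ≈⟨ ·-congʳ (sign e) (*P-congˡ P^k (negVars-·-*P c Z T negVars-Z)) ⟩
    sign e · (P^k *P (c · (Z *P negVars T)))  ≈⟨ ·-congʳ (sign e) (*P-·-comm c P^k (Z *P negVars T)) ⟩
    sign e · c · (P^k *P (Z *P negVars T))    ≈⟨ ·-congʳ (sign e) (·-congʳ c (*P-lcomm P^k Z (negVars T))) ⟩
    sign e · c · (Z *P (P^k *P negVars T))    ≈⟨ ·-comm (sign e) c _ ⟩
    c · sign e · (Z *P (P^k *P negVars T))    ≈⟨ ·-congʳ c (*P-·-comm (sign e) Z (P^k *P negVars T)) ⟨
    c · (Z *P twist e k T)                    ∎
    where
    open ≈P-Reasoning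
    P^k = (1P +P X) ^P k

  twist-Y : ∀ e k T → twist e k (Y *P T) ≈P (ℤ.-1ℤ · (Y *P twist e k T))
  twist-Y e k T = twist-*P e k ℤ.-1ℤ Y T negVars-Y

  twist-X : ∀ e k T → twist (suc e) k (X *P T) ≈P (X *P twist e k T)
  twist-X e k T = begin
    twist (suc e) k (X *P T)                      ≈⟨ twist-*P (suc e) k ℤ.-1ℤ X T negVars-X ⟩
    ℤ.-1ℤ · (X *P twist (suc e) k T)              ≈⟨ ·-congʳ ℤ.-1ℤ (*P-congˡ X (twist-suc e k T)) ⟩
    ℤ.-1ℤ · (X *P (ℤ.-1ℤ · twist e k T))          ≈⟨ ·-congʳ ℤ.-1ℤ (*P-·-comm ℤ.-1ℤ X (twist e k T)) ⟩
    ℤ.-1ℤ · ℤ.-1ℤ · (X *P twist e k T)            ≈⟨ ·-assoc ℤ.-1ℤ ℤ.-1ℤ _ ⟩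
    (+ 1) · (X *P twist e k T)                    ≈⟨ ·-identityˡ _ ⟩
    X *P twist e k T                              ∎
    where open ≈P-Reasoning

  twist-[1+X] : ∀ e k T → twist e (suc k) T ≈P ((1P +P X) *P twist e k T)
  twist-[1+X] e k T = begin
    sign e · (((1P +P X) *P P^k) *P negVars T)   ≈⟨ ·-congʳ (sign e) (*P-assoc (1P +P X) P^k (negVars T)) ⟩
    sign e · ((1P +P X) *P (P^k *P negVars T))   ≈⟨ *P-·-comm (sign e) (1P +P X) (P^k *P negVars T) ⟨
    (1P +P X) *P twist e k T                     ∎
    where
    open ≈P-Reasoning
    P^k = (1P +P X) ^P k

module TwistInjectivity where

  open FiniteSums
  open Polynomials
  open Signs
  open NegatedVariables
  open EvaluationAtMinusOne
  open Twisting using (twist)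

  Natural : Poly → Set
  Natural p = ∀ i j → ∃ λ n → p i j ≡ + n

  record NonzeroℕPoly (p : Poly) : Set where
    field
      natural    : Natural p
      i₀ j₀ n₀   : ℕ
      positive   : p i₀ j₀ ≡ + suc n₀
      degX       : ℕ
      degX-bound : DegX≤ degX p

  open NonzeroℕPoly

  NonzeroℕPoly-resp-≈P : ∀ {p q} → p ≈P q → NonzeroℕPoly p → NonzeroℕPoly q
  NonzeroℕPoly-resp-≈P p≈q P = record
    { natural    = λ i j → proj₁ (natural P i j) , trans (sym (p≈q i j)) (proj₂ (natural P i j))
    ; i₀ = i₀ P ; j₀ = j₀ P ; n₀ = n₀ P
    ; positive   = trans (sym (p≈q (i₀ P) (j₀ P))) (positive P)
    ; degX       = degX P
    ; degX-bound = λ i j lt → trans (sym (p≈q i j)) (degX-bound P i j lt)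
    }

  NonzeroℕPoly-1P : NonzeroℕPoly 1P
  NonzeroℕPoly-1P = record
    { natural = natural-1P ; i₀ = 0 ; j₀ = 0 ; n₀ = 0 ; positive = refl ; degX = 0 ; degX-bound = bound }
    where
    natural-1P : Natural 1P
    natural-1P zero    zero    = 1 , refl
    natural-1P zero    (suc j) = 0 , refl
    natural-1P (suc i) j       = 0 , refl
    bound : DegX≤ 0 1P
    bound (suc i) j _ = refl

  NonzeroℕPoly-+P : ∀ {p q} → NonzeroℕPoly p → NonzeroℕPoly q → NonzeroℕPoly (p +P q)
  NonzeroℕPoly-+P {p} {q} P Q = record
    { natural    = λ i j → add (natural P i j) (natural Q i j)
    ; i₀ = i₀ P ; j₀ = j₀ P ; n₀ = n₀ P ℕ.+ proj₁ (natural Q (i₀ P) (j₀ P))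
    ; positive   = cong₂ _+_ (positive P) (proj₂ (natural Q (i₀ P) (j₀ P)))
    ; degX       = degX P ℕ.+ degX Q
    ; degX-bound = λ i j lt →
        cong₂ _+_ (degX-bound P i j (ℕP.≤-<-trans (ℕP.m≤m+n (degX P) (degX Q)) lt))
                  (degX-bound Q i j (ℕP.≤-<-trans (ℕP.m≤n+m (degX Q) (degX P)) lt))
    }
    where
    add : ∀ {i j} → ∃ (λ n → p i j ≡ + n) → ∃ (λ n → q i j ≡ + n) → ∃ λ n → (p +P q) i j ≡ + n
    add (a , pa) (b , qb) = a ℕ.+ b , cong₂ _+_ pa qb

  NonzeroℕPoly-X*P : ∀ {p} → NonzeroℕPoly p → NonzeroℕPoly (X *P p)
  NonzeroℕPoly-X*P {p} P = NonzeroℕPoly-resp-≈P (≈P-sym (X*P≈shiftX p)) (record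
    { natural    = shifted
    ; i₀ = suc (i₀ P) ; j₀ = j₀ P ; n₀ = n₀ P ; positive = positive P
    ; degX       = suc (degX P)
    ; degX-bound = λ { (suc i) j (s≤s lt) → degX-bound P i j lt }
    })
    where
    shifted : Natural (shiftX p)
    shifted zero    j = 0 , refl
    shifted (suc i) j = natural P i j

  NonzeroℕPoly-Y*P : ∀ {p} → NonzeroℕPoly p → NonzeroℕPoly (Y *P p)
  NonzeroℕPoly-Y*P {p} P = NonzeroℕPoly-resp-≈P (≈P-sym (Y*P≈shiftY p)) (record
    { natural    = shifted
    ; i₀ = i₀ P ; j₀ = suc (j₀ P) ; n₀ = n₀ P ; positive = positive P
    ; degX       = degX P
    ; degX-bound = bound
    })
    where
    shifted : Natural (shiftY p)
    shifted i zero    = 0 , refl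
    shifted i (suc j) = natural P i j
    bound : DegX≤ (degX P) (shiftY p)
    bound i zero    _  = refl
    bound i (suc j) lt = degX-bound P i j lt

  Σ≤-natural : ∀ K (f : ℕ → ℤ) → (∀ i → ∃ λ n → f i ≡ + n) → ∃ λ n → Σ≤ K f ≡ + n
  Σ≤-natural zero    f f-nat = f-nat 0
  Σ≤-natural (suc K) f f-nat with Σ≤-natural K f f-nat | f-nat (suc K)
  ... | a , Σa | b , fb = a ℕ.+ b , cong₂ _+_ Σa fb

  Σ≤-positive : ∀ K (f : ℕ → ℤ) → (∀ i → ∃ λ n → f i ≡ + n) →
                ∀ {i₀ n₀} → i₀ ≤ K → f i₀ ≡ + suc n₀ → ∃ λ n → Σ≤ K f ≡ + suc n
  Σ≤-positive zero    f f-nat z≤n pos = _ , pos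
  Σ≤-positive (suc K) f f-nat i₀≤ pos with ℕP.m≤n⇒m<n∨m≡n i₀≤
  ... | inj₁ (s≤s i₀≤K) with Σ≤-positive K f f-nat i₀≤K pos | f-nat (suc K)
  ...   | a , Σa | b , fb = a ℕ.+ b , cong₂ _+_ Σa fb
  Σ≤-positive (suc K) f f-nat {n₀ = n₀} i₀≤ pos | inj₂ refl with Σ≤-natural K f f-nat
  ...   | a , Σa = a ℕ.+ n₀ , trans (cong₂ _+_ Σa pos) (cong +_ (ℕP.+-suc a n₀))

  -- T(-x,-y) does not vanish at x = -1, while every multiple of 1 + x does.
  no-[1+X]-factor : ∀ {T T′} c d → NonzeroℕPoly T → NonzeroℕPoly T′ →
                    ¬ (negVars T ≈P (c · (((1P +P X) ^P suc d) *P negVars T′)))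
  no-[1+X]-factor {T} {T′} c d P P′ eq = case sign*x≡0⇒x≡0 (j₀ P) _ (trans (sym lhs) rhs) of λ ()
    where
    K = i₀ P ℕ.+ suc (d ℕ.+ degX P′)
    ΣT = Σ≤-positive K (λ i → T i (j₀ P)) (λ i → natural P i (j₀ P)) (ℕP.m≤m+n (i₀ P) _) (positive P)
    lhs : atX=-1 K (negVars T) (j₀ P) ≡ sign (j₀ P) * + suc (proj₁ ΣT)
    lhs = trans (atX=-1-negVars K T (j₀ P)) (cong (sign (j₀ P) *_) (proj₂ ΣT))
    W = ((1P +P X) ^P d) *P negVars T′
    rhs : atX=-1 K (negVars T) (j₀ P) ≡ + 0
    rhs = begin
      atX=-1 K (negVars T) (j₀ P)                                   ≡⟨ atX=-1-cong K eq (j₀ P) ⟩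
      atX=-1 K (c · (((1P +P X) ^P suc d) *P negVars T′)) (j₀ P)    ≡⟨ atX=-1-· K c (((1P +P X) ^P suc d) *P negVars T′) (j₀ P) ⟩
      c * atX=-1 K (((1P +P X) ^P suc d) *P negVars T′) (j₀ P)      ≡⟨ cong (c *_) (atX=-1-cong K (*P-assoc (1P +P X) ((1P +P X) ^P d) (negVars T′)) (j₀ P)) ⟩
      c * atX=-1 K ((1P +P X) *P W) (j₀ P)                          ≡⟨ cong (c *_) (atX=-1-[1+X]*P K W (j₀ P) W-deg (ℕP.m≤n+m _ (i₀ P))) ⟩
      c * + 0                                                       ≡⟨ ℤP.*-zeroʳ c ⟩
      + 0                                                           ∎
      where
      open ≡-Reasoning
      W-deg : DegX≤ (d ℕ.+ degX P′) W
      W-deg = DegX≤-*P {d} {degX P′} {(1P +P X) ^P d} (DegX≤-[1+X]^ d) (DegX≤-negVars (degX-bound P′))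

  no-sign-flip : ∀ {T T′} → NonzeroℕPoly T → NonzeroℕPoly T′ → ¬ (T ≈P (ℤ.-1ℤ · T′))
  no-sign-flip P P′ eq with natural P′ (i₀ P) (j₀ P)
  ... | m , T′≡m = impossible m (trans (sym (positive P)) (trans (eq (i₀ P) (j₀ P)) (cong (ℤ.-1ℤ *_) T′≡m)))
    where
    impossible : ∀ m {n} → + suc n ≡ ℤ.-1ℤ * + m → ⊥
    impossible zero    ()
    impossible (suc m) ()

  twist-cancel : ∀ e e′ k d {T T′} → twist e k T ≈P twist e′ (k ℕ.+ d) T′ →
                 negVars T ≈P (sign (e ℕ.+ e′) · (((1P +P X) ^P d) *P negVars T′))
  twist-cancel e e′ k d {T} {T′} eq = ·-sign-transpose e e′ ([1+X]^*P-cancel k _ _ (begin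
    P^k *P (sign e · negVars T)                   ≈⟨ *P-·-comm (sign e) P^k (negVars T) ⟩
    twist e k T                                   ≈⟨ eq ⟩
    twist e′ (k ℕ.+ d) T′                         ≈⟨ ·-congʳ (sign e′) (*P-cong (^P-+ (1P +P X) k d) (≈P-refl {negVars T′})) ⟩
    sign e′ · ((P^k *P P^d) *P negVars T′)        ≈⟨ ·-congʳ (sign e′) (*P-assoc P^k P^d (negVars T′)) ⟩
    sign e′ · (P^k *P (P^d *P negVars T′))        ≈⟨ *P-·-comm (sign e′) P^k (P^d *P negVars T′) ⟨
    P^k *P (sign e′ · (P^d *P negVars T′))        ∎))
    where
    open ≈P-Reasoning
    P^k = (1P +P X) ^P k
    P^d = (1P +P X) ^P d

  twist-injective-≤ : ∀ e e′ {k k′ T T′} → k ≤ k′ → NonzeroℕPoly T → NonzeroℕPoly T′ →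
                      twist e k T ≈P twist e′ k′ T′ → T ≈P T′
  twist-injective-≤ e e′ {k} {T = T} {T′} k≤k′ P P′ eq with ℕP.m≤n⇒∃[o]m+o≡n k≤k′
  ... | suc d , refl = ⊥-elim (no-[1+X]-factor (sign (e ℕ.+ e′)) d P P′ (twist-cancel e e′ k (suc d) {T} {T′} eq))
  ... | zero  , refl = by-sign (sign≡1⊎sign≡-1 (e ℕ.+ e′))
    where
    s = sign (e ℕ.+ e′)
    T≈s·T′ : T ≈P (s · T′)
    T≈s·T′ = begin
      T                                  ≈⟨ negVars-involutive T ⟨
      negVars (negVars T)                ≈⟨ negVars-cong (twist-cancel e e′ k 0 {T} {T′} eq) ⟩
      negVars (s · (1P *P negVars T′))   ≈⟨ negVars-· s _ ⟩
      s · negVars (1P *P negVars T′)     ≈⟨ ·-congʳ s (negVars-cong (*P-identityˡ (negVars T′))) ⟩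
      s · negVars (negVars T′)           ≈⟨ ·-congʳ s (negVars-involutive T′) ⟩
      s · T′                             ∎
      where open ≈P-Reasoning
    by-sign : s ≡ + 1 ⊎ s ≡ ℤ.-1ℤ → T ≈P T′
    by-sign (inj₁ s≡1)  = ≈P-trans T≈s·T′ (≈P-trans (λ i j → cong (_* T′ i j) s≡1) (·-identityˡ T′))
    by-sign (inj₂ s≡-1) = ⊥-elim (no-sign-flip P P′ (≈P-trans T≈s·T′ (λ i j → cong (_* T′ i j) s≡-1)))

  twist-injective : ∀ e e′ k k′ {T T′} → NonzeroℕPoly T → NonzeroℕPoly T′ →
                    twist e k T ≈P twist e′ k′ T′ → T ≈P T′
  twist-injective e e′ k k′ P P′ eq with ℕP.≤-total k k′
  ... | inj₁ k≤k′ = twist-injective-≤ e e′ k≤k′ P P′ eq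
  ... | inj₂ k′≤k = ≈P-sym (twist-injective-≤ e′ e k′≤k P′ P (≈P-sym eq))

module VertexContraction {m : ℕ} (u v : Fin (suc m)) (u≢v : u ≢ v) where


  private
    c = contractV u v u≢v

  contractV-≢ : ∀ x (x≢v : x ≢ v) → c x ≡ punchOut {i = v} {j = x} (x≢v ∘ sym)
  contractV-≢ x x≢v with x ≟ v
  ... | yes x≡v = ⊥-elim (x≢v x≡v)
  ... | no _    = FinP.punchOut-cong v refl

  contractV-≡ : ∀ x → x ≡ v → c x ≡ punchOut {i = v} {j = u} (u≢v ∘ sym)
  contractV-≡ x refl with v ≟ v
  ... | yes _   = refl
  ... | no v≢v  = ⊥-elim (v≢v refl)

  contractV-identifies : c u ≡ c v
  contractV-identifies = trans (contractV-≢ u u≢v) (sym (contractV-≡ v refl))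

  contractV-punchIn : ∀ z → c (punchIn v z) ≡ z
  contractV-punchIn z =
    trans (contractV-≢ (punchIn v z) (FinP.punchInᵢ≢i v z))
          (trans (FinP.punchOut-cong v refl) (FinP.punchOut-punchIn v))

  Endpoint : Fin (suc m) → Set
  Endpoint x = x ≡ u ⊎ x ≡ v

  contractV-fibre : ∀ x y → c x ≡ c y → x ≡ y ⊎ (Endpoint x × Endpoint y)
  contractV-fibre x y cx≡cy with x ≟ v | y ≟ v
  ... | yes x≡v | yes y≡v = inj₁ (trans x≡v (sym y≡v))
  ... | yes x≡v | no _    = inj₂ (inj₂ x≡v , inj₁ (sym (FinP.punchOut-injective {i = v} _ _ cx≡cy)))
  ... | no _    | yes y≡v = inj₂ (inj₁ (FinP.punchOut-injective {i = v} _ _ cx≡cy) , inj₂ y≡v)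
  ... | no _    | no _    = inj₁ (FinP.punchOut-injective {i = v} _ _ cx≡cy)

  contractV-endpoints : ∀ {x y} → Endpoint x → Endpoint y → c x ≡ c y
  contractV-endpoints (inj₁ refl) (inj₁ refl) = refl
  contractV-endpoints (inj₁ refl) (inj₂ refl) = contractV-identifies
  contractV-endpoints (inj₂ refl) (inj₁ refl) = sym contractV-identifies
  contractV-endpoints (inj₂ refl) (inj₂ refl) = refl

module ClassCounting where


  #true : ∀ {n} → (Fin n → Bool) → ℕ
  #true {zero}  f = 0
  #true {suc n} f = (if f Fin.zero then 1 else 0) ℕ.+ #true (f ∘ Fin.suc)

  #true-cong : ∀ {n} {f g : Fin n → Bool} → (∀ x → f x ≡ g x) → #true f ≡ #true g
  #true-cong {zero}  f≡g = refl
  #true-cong {suc n} f≡g =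
    cong₂ (λ b r → (if b then 1 else 0) ℕ.+ r) (f≡g Fin.zero) (#true-cong (f≡g ∘ Fin.suc))

  #true≤n : ∀ {n} (f : Fin n → Bool) → #true f ≤ n
  #true≤n {zero}  f = z≤n
  #true≤n {suc n} f with f Fin.zero
  ... | true  = s≤s (#true≤n (f ∘ Fin.suc))
  ... | false = ℕP.m≤n⇒m≤1+n (#true≤n (f ∘ Fin.suc))

  #true-fromℕ : ∀ n (f : Fin (suc n) → Bool) →
                #true f ≡ #true (f ∘ inject₁) ℕ.+ (if f (fromℕ n) then 1 else 0)
  #true-fromℕ zero    f = ℕP.+-comm (if f Fin.zero then 1 else 0) 0
  #true-fromℕ (suc n) f =
    trans (cong ((if f Fin.zero then 1 else 0) ℕ.+_) (#true-fromℕ n (f ∘ Fin.suc)))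
          (sym (ℕP.+-assoc (if f Fin.zero then 1 else 0) (#true (f ∘ Fin.suc ∘ inject₁)) _))

  #true-mono : ∀ {n} (f g : Fin n → Bool) → (∀ x → f x ≡ true → g x ≡ true) → #true f ≤ #true g
  #true-mono {zero}  f g f⇒g = z≤n
  #true-mono {suc n} f g f⇒g with f Fin.zero in f0 | g Fin.zero in g0
  ... | true  | true  = s≤s (#true-mono (f ∘ Fin.suc) (g ∘ Fin.suc) (f⇒g ∘ Fin.suc))
  ... | false | true  = ℕP.m≤n⇒m≤1+n (#true-mono (f ∘ Fin.suc) (g ∘ Fin.suc) (f⇒g ∘ Fin.suc))
  ... | false | false = #true-mono (f ∘ Fin.suc) (g ∘ Fin.suc) (f⇒g ∘ Fin.suc)
  ... | true  | false with trans (sym (f⇒g Fin.zero f0)) g0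
  ...   | ()

  #true-strict : ∀ {n} (f g : Fin n → Bool) → (∀ x → f x ≡ true → g x ≡ true) →
                 ∀ y → f y ≡ false → g y ≡ true → #true f < #true g
  #true-strict {suc n} f g f⇒g Fin.zero    fy gy rewrite fy | gy =
    s≤s (#true-mono (f ∘ Fin.suc) (g ∘ Fin.suc) (f⇒g ∘ Fin.suc))
  #true-strict {suc n} f g f⇒g (Fin.suc y) fy gy with f Fin.zero in f0 | g Fin.zero in g0
  ... | true  | true  = s≤s (#true-strict (f ∘ Fin.suc) (g ∘ Fin.suc) (f⇒g ∘ Fin.suc) y fy gy)
  ... | false | true  = ℕP.m≤n⇒m≤1+n (#true-strict (f ∘ Fin.suc) (g ∘ Fin.suc) (f⇒g ∘ Fin.suc) y fy gy)
  ... | false | false = #true-strict (f ∘ Fin.suc) (g ∘ Fin.suc) (f⇒g ∘ Fin.suc) y fy gy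
  ... | true  | false with trans (sym (f⇒g Fin.zero f0)) g0
  ...   | ()

  length-filter-tabulate : ∀ {A : Set} {n} (f : A → Bool) (f? : ∀ x → Dec (T (f x))) (h : Fin n → A) →
                           length (filter f? (tabulate h)) ≡ #true (f ∘ h)
  length-filter-tabulate {n = zero}  f f? h = refl
  length-filter-tabulate {n = suc n} f f? h with f (h Fin.zero) | f? (h Fin.zero)
  ... | true  | yes _ = cong suc (length-filter-tabulate f f? (h ∘ Fin.suc))
  ... | true  | no ¬t = ⊥-elim (¬t tt)
  ... | false | no _  = length-filter-tabulate f f? (h ∘ Fin.suc)

  any-tabulate-false : ∀ {A : Set} {n} (q : A → Bool) (h : Fin n → A) →
                       any q (tabulate h) ≡ false → ∀ i → q (h i) ≡ false
  any-tabulate-false {n = suc n} q h none i with q (h Fin.zero) in q0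
  any-tabulate-false {n = suc n} q h none Fin.zero    | false = q0
  any-tabulate-false {n = suc n} q h none (Fin.suc i) | false = any-tabulate-false q (h ∘ Fin.suc) none i

  any-tabulate-true : ∀ {A : Set} {n} (q : A → Bool) (h : Fin n → A) →
                      any q (tabulate h) ≡ true → ∃ λ i → q (h i) ≡ true
  any-tabulate-true {n = suc n} q h some with q (h Fin.zero) in q0
  ... | true  = Fin.zero , q0
  ... | false with any-tabulate-true q (h ∘ Fin.suc) some
  ...   | i , qi = Fin.suc i , qi

  Rel : ℕ → Set
  Rel n = Fin n → Fin n → Bool

  Holds : ∀ {n} → Rel n → Fin n → Fin n → Set
  Holds R a b = R a b ≡ true

  -- Each class is counted through its least member, exactly as b₀ counts components.
  least : ∀ {n} → Rel n → Fin n → Bool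
  least {n} R v = not (any (λ w → (toℕ w ℕ.<ᵇ toℕ v) ∧ R w v) (allFin n))

  #classes : ∀ {n} → Rel n → ℕ
  #classes R = #true (least R)

  data LeastView {n} (R : Rel n) (v : Fin n) : Set where
    is-least     : least R v ≡ true → (∀ w → toℕ w < toℕ v → R w v ≡ false) → LeastView R v
    is-not-least : least R v ≡ false → ∀ w → toℕ w < toℕ v → R w v ≡ true → LeastView R v

  least⇒no-smaller : ∀ {n} (R : Rel n) v → least R v ≡ true → ∀ w → toℕ w < toℕ v → R w v ≡ false
  least⇒no-smaller {n} R v l w w<v with any (λ w → (toℕ w ℕ.<ᵇ toℕ v) ∧ R w v) (allFin n) in smaller
  least⇒no-smaller {n} R v refl w w<v | false
    with toℕ w ℕ.<ᵇ toℕ v | ℕP.<⇒<ᵇ w<v | any-tabulate-false _ (λ x → x) smaller w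
  ... | true | _ | Rwv≡false = Rwv≡false

  ¬least⇒smaller : ∀ {n} (R : Rel n) v → least R v ≡ false → ∃ λ w → toℕ w < toℕ v × R w v ≡ true
  ¬least⇒smaller {n} R v l with any (λ w → (toℕ w ℕ.<ᵇ toℕ v) ∧ R w v) (allFin n) in smaller
  ¬least⇒smaller {n} R v refl | true with any-tabulate-true _ (λ x → x) smaller
  ... | w , r with toℕ w ℕ.<ᵇ toℕ v in w<ᵇv | R w v in Rwv
  ...   | true | true = w , ℕP.<ᵇ⇒< (toℕ w) (toℕ v) (subst T (sym w<ᵇv) tt) , Rwv

  leastView : ∀ {n} (R : Rel n) v → LeastView R v
  leastView R v with least R v in l
  ... | true  = is-least l (least⇒no-smaller R v l)
  ... | false with ¬least⇒smaller R v l
  ...   | w , w<v , Rwv = is-not-least l w w<v Rwv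

  least-cong : ∀ {n} (R R′ : Rel n) v → (∀ w → toℕ w < toℕ v → R w v ≡ R′ w v) → least R v ≡ least R′ v
  least-cong R R′ v R≡R′ with leastView R v | leastView R′ v
  ... | is-least l _           | is-least l′ _            = trans l (sym l′)
  ... | is-not-least l _ _ _   | is-not-least l′ _ _ _    = trans l (sym l′)
  ... | is-least _ none        | is-not-least _ w w<v Rwv with trans (sym (none w w<v)) (trans (R≡R′ w w<v) Rwv)
  ...   | ()
  least-cong R R′ v R≡R′ | is-not-least _ w w<v Rwv | is-least _ none with trans (sym Rwv) (trans (R≡R′ w w<v) (none w w<v))
  ...   | ()

  #classes-cong : ∀ {n} (R R′ : Rel n) → (∀ a b → R a b ≡ R′ a b) → #classes R ≡ #classes R′
  #classes-cong R R′ R≡R′ = #true-cong (λ v → least-cong R R′ v (λ w _ → R≡R′ w v))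

  restrict : ∀ {n} → Rel (suc n) → Rel n
  restrict R a b = R (inject₁ a) (inject₁ b)

  inject₁<fromℕ : ∀ {n} (a : Fin n) → toℕ (inject₁ a) < toℕ (fromℕ n)
  inject₁<fromℕ {n} a = subst₂ _<_ (sym (FinP.toℕ-inject₁ a)) (sym (FinP.toℕ-fromℕ n)) (FinP.toℕ<n a)

  least-inject₁ : ∀ {n} (R : Rel (suc n)) a → least R (inject₁ a) ≡ least (restrict R) a
  least-inject₁ {n} R a with leastView R (inject₁ a) | leastView (restrict R) a
  ... | is-least l _         | is-least l′ _          = trans l (sym l′)
  ... | is-not-least l _ _ _ | is-not-least l′ _ _ _  = trans l (sym l′)
  ... | is-least _ none | is-not-least _ w w<a Rwa
    with trans (sym (none (inject₁ w) (subst₂ _<_ (sym (FinP.toℕ-inject₁ w)) (sym (FinP.toℕ-inject₁ a)) w<a))) Rwa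
  ...   | ()
  least-inject₁ {n} R a | is-not-least _ w w<a Rwa | is-least _ none with view w
  ... | ‵fromℕ = ⊥-elim (ℕP.<-asym w<a (inject₁<fromℕ a))
  ... | ‵inj₁ {i = w′} _
    with trans (sym Rwa) (none w′ (subst₂ _<_ (FinP.toℕ-inject₁ w′) (FinP.toℕ-inject₁ a) w<a))
  ...   | ()

  #classes-fromℕ : ∀ {n} (R : Rel (suc n)) →
                   #classes R ≡ #classes (restrict R) ℕ.+ (if least R (fromℕ n) then 1 else 0)
  #classes-fromℕ {n} R =
    trans (#true-fromℕ n (least R)) (cong (ℕ._+ (if least R (fromℕ n) then 1 else 0)) (#true-cong (least-inject₁ R)))

  record Quotient {n} (R : Rel n) (k : ℕ) : Set where
    field
      cls        : Fin n → Fin k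
      sound      : ∀ {a b} → R a b ≡ true → cls a ≡ cls b
      exact      : ∀ {a b} → cls a ≡ cls b → R a b ≡ true
      surjective : ∀ y → ∃ λ a → cls a ≡ y

  open Quotient

  Quotient-≤ : ∀ {n k k′} {R : Rel n} → Quotient R k → Quotient R k′ → k ≤ k′
  Quotient-≤ Q Q′ = FinP.injective⇒≤ {f = λ y → cls Q′ (section y)} injective
    where
    section = λ y → proj₁ (surjective Q y)
    injective : ∀ {x y} → cls Q′ (section x) ≡ cls Q′ (section y) → x ≡ y
    injective {x} {y} eq =
      trans (sym (proj₂ (surjective Q x))) (trans (sound Q (exact Q′ eq)) (proj₂ (surjective Q y)))

  Quotient-unique : ∀ {n k k′} {R : Rel n} → Quotient R k → Quotient R k′ → k ≡ k′
  Quotient-unique Q Q′ = ℕP.≤-antisym (Quotient-≤ Q Q′) (Quotient-≤ Q′ Q)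

  lastCase : ∀ {A : Set} {n} → (Fin n → A) → A → Fin (suc n) → A
  lastCase f z x with view x
  ... | ‵fromℕ          = z
  ... | ‵inj₁ {i = a} _ = f a

  lastCase-inject₁ : ∀ {A : Set} {n} (f : Fin n → A) z a → lastCase f z (inject₁ a) ≡ f a
  lastCase-inject₁ f z a rewrite view-inject₁ a = refl

  module Extend {n} {R : Rel (suc n)} (R-equiv : IsEquivalence (Holds R)) {k} (Q : Quotient (restrict R) k) where

    open IsEquivalence R-equiv renaming (refl to R-refl; sym to R-sym; trans to R-trans)

    quotient-new-class : (∀ a → R (inject₁ a) (fromℕ n) ≡ false) → Quotient R (suc k)
    quotient-new-class isolated = record
      { cls = cls′ ; sound = sound′ ; exact = exact′ ; surjective = surjective′ }
      where
      cls′ = lastCase (inject₁ ∘ cls Q) (fromℕ k)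
      sound′ : ∀ {x y} → R x y ≡ true → cls′ x ≡ cls′ y
      sound′ {x} {y} Rxy with view x | view y
      ... | ‵inj₁ _ | ‵inj₁ _ = cong inject₁ (sound Q Rxy)
      ... | ‵inj₁ {i = a} _ | ‵fromℕ = case trans (sym Rxy) (isolated a) of λ ()
      ... | ‵fromℕ | ‵inj₁ {i = b} _ = case trans (sym (R-sym Rxy)) (isolated b) of λ ()
      ... | ‵fromℕ | ‵fromℕ = refl
      exact′ : ∀ {x y} → cls′ x ≡ cls′ y → R x y ≡ true
      exact′ {x} {y} eq with view x | view y
      ... | ‵inj₁ _ | ‵inj₁ _ = exact Q (FinP.inject₁-injective eq)
      ... | ‵inj₁ _ | ‵fromℕ  = ⊥-elim (FinP.fromℕ≢inject₁ (sym eq))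
      ... | ‵fromℕ  | ‵inj₁ _ = ⊥-elim (FinP.fromℕ≢inject₁ eq)
      ... | ‵fromℕ  | ‵fromℕ  = R-refl
      surjective′ : ∀ y → ∃ λ x → cls′ x ≡ y
      surjective′ y with view y
      ... | ‵fromℕ = fromℕ n , cls′-top
        where
        cls′-top : cls′ (fromℕ n) ≡ fromℕ k
        cls′-top rewrite view-fromℕ n = refl
      ... | ‵inj₁ {i = c} _ with surjective Q c
      ...   | a , a↦c = inject₁ a , trans (lastCase-inject₁ (inject₁ ∘ cls Q) (fromℕ k) a) (cong inject₁ a↦c)

    quotient-old-class : ∀ w → R (inject₁ w) (fromℕ n) ≡ true → Quotient R k
    quotient-old-class w Rw = record
      { cls = cls′ ; sound = sound′ ; exact = exact′ ; surjective = surjective′ }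
      where
      cls′ = lastCase (cls Q) (cls Q w)
      sound′ : ∀ {x y} → R x y ≡ true → cls′ x ≡ cls′ y
      sound′ {x} {y} Rxy with view x | view y
      ... | ‵inj₁ _ | ‵inj₁ _ = sound Q Rxy
      ... | ‵inj₁ _ | ‵fromℕ  = sound Q (R-trans Rxy (R-sym Rw))
      ... | ‵fromℕ  | ‵inj₁ _ = sound Q (R-trans Rw Rxy)
      ... | ‵fromℕ  | ‵fromℕ  = refl
      exact′ : ∀ {x y} → cls′ x ≡ cls′ y → R x y ≡ true
      exact′ {x} {y} eq with view x | view y
      ... | ‵inj₁ _ | ‵inj₁ _ = exact Q eq
      ... | ‵inj₁ _ | ‵fromℕ  = R-trans (exact Q eq) Rw
      ... | ‵fromℕ  | ‵inj₁ _ = R-trans (R-sym Rw) (exact Q eq)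
      ... | ‵fromℕ  | ‵fromℕ  = R-refl
      surjective′ : ∀ y → ∃ λ x → cls′ x ≡ y
      surjective′ y with surjective Q y
      ... | a , a↦y = inject₁ a , trans (lastCase-inject₁ (cls Q) (cls Q w) a) a↦y

  restrict-isEquivalence : ∀ {n} {R : Rel (suc n)} → IsEquivalence (Holds R) → IsEquivalence (Holds (restrict R))
  restrict-isEquivalence R-equiv = record { refl = refl′ ; sym = sym′ ; trans = trans′ }
    where open IsEquivalence R-equiv renaming (refl to refl′; sym to sym′; trans to trans′)

  quotient : ∀ {n} (R : Rel n) → IsEquivalence (Holds R) → Quotient R (#classes R)
  quotient {zero}  R _ = record { cls = λ () ; sound = λ { {()} } ; exact = λ { {()} } ; surjective = λ () }
  quotient {suc n} R R-equiv with leastView R (fromℕ n)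
  ... | is-least l none =
    subst (Quotient R) (sym count) (quotient-new-class (λ a → none (inject₁ a) (inject₁<fromℕ a)))
    where
    open Extend R-equiv (quotient (restrict R) (restrict-isEquivalence R-equiv))
    count : #classes R ≡ suc (#classes (restrict R))
    count = trans (#classes-fromℕ R) (trans (cong (λ b → #classes (restrict R) ℕ.+ (if b then 1 else 0)) l) (ℕP.+-comm _ 1))
  ... | is-not-least l w w<top Rw with view w
  ...   | ‵fromℕ = ⊥-elim (ℕP.<-irrefl refl w<top)
  ...   | ‵inj₁ {i = w′} _ = subst (Quotient R) (sym count) (quotient-old-class w′ Rw)
    where
    open Extend R-equiv (quotient (restrict R) (restrict-isEquivalence R-equiv))
    count : #classes R ≡ #classes (restrict R)
    count = trans (#classes-fromℕ R) (trans (cong (λ b → #classes (restrict R) ℕ.+ (if b then 1 else 0)) l) (ℕP.+-identityʳ _))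

  #classes-≡ : ∀ {n k} {R : Rel n} → IsEquivalence (Holds R) → Quotient R k → #classes R ≡ k
  #classes-≡ {R = R} R-equiv Q = Quotient-unique (quotient R R-equiv) Q

  deleteVertex : ∀ {m} → Fin (suc m) → Rel (suc m) → Rel m
  deleteVertex v R y z = R (punchIn v y) (punchIn v z)

  #classes-deleteVertex : ∀ {m} (R : Rel (suc m)) {u v} → IsEquivalence (Holds R) →
                          R u v ≡ true → u ≢ v → #classes (deleteVertex v R) ≡ #classes R
  #classes-deleteVertex R {u} {v} R-equiv Ruv u≢v = #classes-≡ R′-equiv (record
    { cls = cls Q ∘ punchIn v ; sound = sound Q ; exact = exact Q ; surjective = surjective′ })
    where
    open IsEquivalence R-equiv renaming (refl to R-refl; sym to R-sym; trans to R-trans)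
    R′-equiv : IsEquivalence (Holds (deleteVertex v R))
    R′-equiv = record { refl = R-refl ; sym = R-sym ; trans = R-trans }
    Q = quotient R R-equiv
    surjective′ : ∀ y → ∃ λ a → cls Q (punchIn v a) ≡ y
    surjective′ y with surjective Q y
    ... | a , a↦y with a ≟ v
    ...   | no a≢v    = punchOut (a≢v ∘ sym) , trans (cong (cls Q) (FinP.punchIn-punchOut _)) a↦y
    ...   | yes refl  = punchOut (u≢v ∘ sym) , trans (cong (cls Q) (FinP.punchIn-punchOut _)) (trans (sound Q Ruv) a↦y)

  module Merge {n} {R R′ : Rel n} (R-equiv : IsEquivalence (Holds R)) (R′-equiv : IsEquivalence (Holds R′))
               {u v : Fin n} (Ruv : R u v ≡ false) where

    Near : Fin n → Set
    Near a = R a u ≡ true ⊎ R a v ≡ true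

    Merged : Fin n → Fin n → Set
    Merged a b = R a b ≡ true ⊎ (Near a × Near b)

    module _ (merged⇒ : ∀ {a b} → R′ a b ≡ true → Merged a b)
             (⇒merged : ∀ {a b} → Merged a b → R′ a b ≡ true) where

      merge-quotient : ∀ {k} → Quotient R (suc k) → Quotient R′ k
      merge-quotient Q = record { cls = cls′ ; sound = sound′ ; exact = exact′ ; surjective = surjective′ }
        where
        u≁v : cls Q u ≢ cls Q v
        u≁v eq = case trans (sym Ruv) (exact Q eq) of λ ()
        open VertexContraction (cls Q u) (cls Q v) u≁v
        cls′ = contractV (cls Q u) (cls Q v) u≁v ∘ cls Q
        toEndpoint : ∀ {a} → Near a → Endpoint (cls Q a)
        toEndpoint (inj₁ Rau) = inj₁ (sound Q Rau)
        toEndpoint (inj₂ Rav) = inj₂ (sound Q Rav)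
        fromEndpoint : ∀ {a} → Endpoint (cls Q a) → Near a
        fromEndpoint (inj₁ a↦u) = inj₁ (exact Q a↦u)
        fromEndpoint (inj₂ a↦v) = inj₂ (exact Q a↦v)
        sound′ : ∀ {a b} → R′ a b ≡ true → cls′ a ≡ cls′ b
        sound′ R′ab with merged⇒ R′ab
        ... | inj₁ Rab            = cong (contractV (cls Q u) (cls Q v) u≁v) (sound Q Rab)
        ... | inj₂ (near-a , near-b) = contractV-endpoints (toEndpoint near-a) (toEndpoint near-b)
        exact′ : ∀ {a b} → cls′ a ≡ cls′ b → R′ a b ≡ true
        exact′ {a} {b} eq with contractV-fibre (cls Q a) (cls Q b) eq
        ... | inj₁ a≡b        = ⇒merged (inj₁ (exact Q a≡b))
        ... | inj₂ (ea , eb)  = ⇒merged (inj₂ (fromEndpoint ea , fromEndpoint eb))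
        surjective′ : ∀ z → ∃ λ a → cls′ a ≡ z
        surjective′ z with surjective Q (punchIn (cls Q v) z)
        ... | a , a↦ = a , trans (cong (contractV (cls Q u) (cls Q v) u≁v) a↦) (contractV-punchIn z)

      #classes-merge : suc (#classes R′) ≡ #classes R
      #classes-merge = from-quotient (#classes R) (quotient R R-equiv)
        where
        from-quotient : ∀ k → Quotient R k → suc (#classes R′) ≡ k
        from-quotient zero    Q = case cls Q u of λ ()
        from-quotient (suc k) Q = cong suc (#classes-≡ R′-equiv (merge-quotient Q))

module Walks where

  open ClassCounting using (#true; #true≤n; #true-mono; #true-strict)

  any-true⇒∈ : ∀ {A : Set} (q : A → Bool) xs → any q xs ≡ true → ∃ λ x → x ∈ xs × q x ≡ true
  any-true⇒∈ q (x ∷ xs) some with q x in qx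
  ... | true  = x , here refl , qx
  ... | false with any-true⇒∈ q xs some
  ...   | y , y∈xs , qy = y , there y∈xs , qy

  ∈⇒any-true : ∀ {A : Set} (q : A → Bool) {xs x} → x ∈ xs → q x ≡ true → any q xs ≡ true
  ∈⇒any-true q {x ∷ xs} (here refl) qx rewrite qx = refl
  ∈⇒any-true q {x ∷ xs} (there y∈xs) qy rewrite ∈⇒any-true q y∈xs qy = BoolP.∨-zeroʳ (q x)

  any-cong : ∀ {A : Set} {q q′ : A → Bool} xs → (∀ x → q x ≡ q′ x) → any q xs ≡ any q′ xs
  any-cong []       q≡q′ = refl
  any-cong (x ∷ xs) q≡q′ = cong₂ _∨_ (q≡q′ x) (any-cong xs q≡q′)

  ∨-true : ∀ {a b} → a ∨ b ≡ true → a ≡ true ⊎ b ≡ true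
  ∨-true {true}  _ = inj₁ refl
  ∨-true {false} b = inj₂ b

  ∧-true : ∀ {a b} → a ∧ b ≡ true → a ≡ true × b ≡ true
  ∧-true {true} {true} _ = refl , refl

  ∨-trueˡ : ∀ {a} b → a ≡ true → a ∨ b ≡ true
  ∨-trueˡ b refl = refl

  ∨-trueʳ : ∀ a {b} → b ≡ true → a ∨ b ≡ true
  ∨-trueʳ true  _ = refl
  ∨-trueʳ false b = b

  ≟-true : ∀ {n} {a b : Fin n} → ⌊ a ≟ b ⌋ ≡ true → a ≡ b
  ≟-true {a = a} {b} eq with a ≟ b
  ... | yes a≡b = a≡b

  ≟-refl : ∀ {n} (a : Fin n) → ⌊ a ≟ a ⌋ ≡ true
  ≟-refl a with a ≟ a
  ... | yes _   = refl
  ... | no a≢a  = ⊥-elim (a≢a refl)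

  Adjacent : ∀ {n} → Edges n → Fin n → Fin n → Set
  Adjacent es b c = (b , c) ∈ es ⊎ (c , b) ∈ es

  infixl 5 _▸_

  data Walk {n} (es : Edges n) (a : Fin n) : Fin n → Set where
    ε   : Walk es a a
    _▸_ : ∀ {b c} → Walk es a b → Adjacent es b c → Walk es a c

  Adjacent-sym : ∀ {n} {es : Edges n} {b c} → Adjacent es b c → Adjacent es c b
  Adjacent-sym (inj₁ bc) = inj₂ bc
  Adjacent-sym (inj₂ cb) = inj₁ cb

  walk-edge : ∀ {n} {es : Edges n} {a b} → Adjacent es a b → Walk es a b
  walk-edge e = ε ▸ e

  walk-trans : ∀ {n} {es : Edges n} {a b c} → Walk es a b → Walk es b c → Walk es a c
  walk-trans p ε       = p
  walk-trans p (q ▸ e) = walk-trans p q ▸ e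

  walk-sym : ∀ {n} {es : Edges n} {a b} → Walk es a b → Walk es b a
  walk-sym ε       = ε
  walk-sym (p ▸ e) = walk-trans (walk-edge (Adjacent-sym e)) (walk-sym p)

  walk-mono : ∀ {n} {es es′ : Edges n} → (∀ {e} → e ∈ es → e ∈ es′) → ∀ {a b} → Walk es a b → Walk es′ a b
  walk-mono ⊆ ε               = ε
  walk-mono ⊆ (p ▸ inj₁ e∈es) = walk-mono ⊆ p ▸ inj₁ (⊆ e∈es)
  walk-mono ⊆ (p ▸ inj₂ e∈es) = walk-mono ⊆ p ▸ inj₂ (⊆ e∈es)

  conn⇒walk : ∀ {n} k (es : Edges n) u v → conn k es u v ≡ true → Walk es u v
  conn⇒walk zero    es u v u≡v rewrite ≟-true u≡v = ε
  conn⇒walk (suc k) es u v c with ∨-true {conn k es u v} c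
  ... | inj₁ shorter = conn⇒walk k es u v shorter
  ... | inj₂ step with any-true⇒∈ _ es step
  ...   | (x , y) , xy∈es , last with ∨-true {conn k es u x ∧ ⌊ y ≟ v ⌋} last
  ...     | inj₁ via-x with ∧-true {conn k es u x} via-x
  ...       | ux , y≡v = conn⇒walk k es u x ux ▸ inj₁ (subst (λ z → (x , z) ∈ es) (≟-true y≡v) xy∈es)
  conn⇒walk (suc k) es u v c | inj₂ step | (x , y) , xy∈es , last | inj₂ via-y with ∧-true {conn k es u y} via-y
  ...       | uy , x≡v = conn⇒walk k es u y uy ▸ inj₂ (subst (λ z → (z , y) ∈ es) (≟-true x≡v) xy∈es)

  walk⇒conn : ∀ {n} (es : Edges n) u v → Walk es u v → ∃ λ k → conn k es u v ≡ true
  walk⇒conn es u .u ε = 0 , ≟-refl u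
  walk⇒conn es u v (_▸_ {b} p (inj₁ bv∈es)) with walk⇒conn es u b p
  ... | k , ub = suc k , ∨-trueʳ (conn k es u v)
                           (∈⇒any-true _ bv∈es (∨-trueˡ _ (cong₂ _∧_ ub (≟-refl v))))
  walk⇒conn es u v (_▸_ {b} p (inj₂ vb∈es)) with walk⇒conn es u b p
  ... | k , ub = suc k , ∨-trueʳ (conn k es u v)
                           (∈⇒any-true _ vb∈es (∨-trueʳ (conn k es u v ∧ ⌊ b ≟ v ⌋) (cong₂ _∧_ ub (≟-refl v))))

  conn-suc : ∀ {n} k (es : Edges n) u v → conn k es u v ≡ true → conn (suc k) es u v ≡ true
  conn-suc k es u v = ∨-trueˡ _

  conn-mono : ∀ {n} {k k′} (es : Edges n) u v → k ≤ k′ → conn k es u v ≡ true → conn k′ es u v ≡ true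
  conn-mono {k = k} es u v k≤k′ c with ℕP.m≤n⇒∃[o]m+o≡n k≤k′
  ... | o , refl = go o
    where
    go : ∀ o → conn (k ℕ.+ o) es u v ≡ true
    go zero    rewrite ℕP.+-identityʳ k = c
    go (suc o) rewrite ℕP.+-suc k o     = conn-suc (k ℕ.+ o) es u v (go o)

  Stable : ∀ {n} → Edges n → Fin n → ℕ → Set
  Stable es u j = ∀ x → conn (suc j) es u x ≡ conn j es u x

  conn-stable : ∀ {n} j (es : Edges n) u → Stable es u j → ∀ i x → conn (i ℕ.+ j) es u x ≡ conn j es u x
  conn-stable j es u stable zero    x = refl
  conn-stable j es u stable (suc i) x = trans (next x) (stable x)
    where
    ih = conn-stable j es u stable i
    next : ∀ v → conn (suc (i ℕ.+ j)) es u v ≡ conn (suc j) es u v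
    next v = cong₂ _∨_ (ih v) (any-cong es λ { (a , b) →
               cong₂ _∨_ (cong (_∧ ⌊ b ≟ v ⌋) (ih a)) (cong (_∧ ⌊ a ≟ v ⌋) (ih b)) })

  ≡-or-gap : ∀ {n} (f g : Fin n → Bool) → (∀ x → f x ≡ true → g x ≡ true) →
             (∀ x → g x ≡ f x) ⊎ ∃ λ x → f x ≡ false × g x ≡ true
  ≡-or-gap {zero}  f g f⇒g = inj₁ λ ()
  ≡-or-gap {suc n} f g f⇒g with ≡-or-gap (f ∘ Fin.suc) (g ∘ Fin.suc) (f⇒g ∘ Fin.suc) | f Fin.zero in f0 | g Fin.zero in g0
  ... | inj₂ (x , fx , gx) | _     | _     = inj₂ (Fin.suc x , fx , gx)
  ... | inj₁ _             | false | true  = inj₂ (Fin.zero , f0 , g0)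
  ... | inj₁ rest          | true  | true  = inj₁ λ { Fin.zero → trans g0 (sym f0) ; (Fin.suc x) → rest x }
  ... | inj₁ rest          | false | false = inj₁ λ { Fin.zero → trans g0 (sym f0) ; (Fin.suc x) → rest x }
  ... | inj₁ _             | true  | false with trans (sym (f⇒g Fin.zero f0)) g0
  ...   | ()

  -- Until it stabilises, each round of conn reaches at least one new vertex.
  stabilises-or-grows : ∀ {n} (es : Edges n) u k →
                        (∃ λ j → j ≤ k × Stable es u j) ⊎ suc k ≤ #true (conn k es u)
  stabilises-or-grows es u zero =
    inj₂ (ℕP.≤-trans (s≤s z≤n) (#true-strict (λ _ → false) (conn 0 es u) (λ _ ()) u refl (≟-refl u)))
  stabilises-or-grows es u (suc k) with stabilises-or-grows es u k
  ... | inj₁ (j , j≤k , stable) = inj₁ (j , ℕP.m≤n⇒m≤1+n j≤k , stable)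
  ... | inj₂ grown with ≡-or-gap (conn k es u) (conn (suc k) es u) (conn-suc k es u)
  ...   | inj₁ stable           = inj₁ (k , ℕP.n≤1+n k , stable)
  ...   | inj₂ (y , new , old)  =
    inj₂ (ℕP.≤-trans (s≤s grown) (#true-strict (conn k es u) (conn (suc k) es u) (conn-suc k es u) y new old))

  conn⇒connected : ∀ {n} (es : Edges n) u v k → conn k es u v ≡ true → connected es u v ≡ true
  conn⇒connected {n} es u v k c with stabilises-or-grows es u n
  ... | inj₂ too-many = ⊥-elim (ℕP.<-irrefl refl (ℕP.<-≤-trans too-many (#true≤n (conn n es u))))
  ... | inj₁ (j , j≤n , stable) with ℕP.≤-total k j
  ...   | inj₁ k≤j = conn-mono es u v (ℕP.≤-trans k≤j j≤n) c
  ...   | inj₂ j≤k with ℕP.m≤n⇒∃[o]m+o≡n j≤k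
  ...     | o , refl = conn-mono es u v j≤n
                         (trans (sym (conn-stable j es u stable o v)) (subst (λ i → conn i es u v ≡ true) (ℕP.+-comm j o) c))

  walk⇒connected : ∀ {n} (es : Edges n) {u v} → Walk es u v → connected es u v ≡ true
  walk⇒connected es {u} {v} p with walk⇒conn es u v p
  ... | k , c = conn⇒connected es u v k c

  connected⇒walk : ∀ {n} (es : Edges n) {u v} → connected es u v ≡ true → Walk es u v
  connected⇒walk {n} es {u} {v} = conn⇒walk n es u v

module Components where

  open ClassCounting
  open Walks

  ⇔true⇒≡ : ∀ {a b : Bool} → (a ≡ true → b ≡ true) → (b ≡ true → a ≡ true) → a ≡ b
  ⇔true⇒≡ {true}  {true}  _   _   = refl
  ⇔true⇒≡ {true}  {false} a⇒b _   = sym (a⇒b refl)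
  ⇔true⇒≡ {false} {true}  _   b⇒a = b⇒a refl
  ⇔true⇒≡ {false} {false} _   _   = refl

  connected-isEquivalence : ∀ {n} (es : Edges n) → IsEquivalence (Holds (connected es))
  connected-isEquivalence es = record
    { refl  = walk⇒connected es ε
    ; sym   = λ c → walk⇒connected es (walk-sym (connected⇒walk es c))
    ; trans = λ c d → walk⇒connected es (walk-trans (connected⇒walk es c) (connected⇒walk es d))
    }

  b₀≡#classes : ∀ {n} (es : Edges n) → b₀ es ≡ #classes (connected es)
  b₀≡#classes {n} es = length-filter-tabulate {n = n} (least (connected es)) _ (λ x → x)

  b₀-resp-walks : ∀ {n} (es es′ : Edges n) → (∀ {a b} → Walk es a b → Walk es′ a b) →
                  (∀ {a b} → Walk es′ a b → Walk es a b) → b₀ es ≡ b₀ es′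
  b₀-resp-walks es es′ to from = begin
    b₀ es                       ≡⟨ b₀≡#classes es ⟩
    #classes (connected es)     ≡⟨ #classes-cong _ _ same ⟩
    #classes (connected es′)    ≡⟨ b₀≡#classes es′ ⟨
    b₀ es′                      ∎
    where
    open ≡-Reasoning
    same : ∀ a b → connected es a b ≡ connected es′ a b
    same a b = ⇔true⇒≡ (λ c → walk⇒connected es′ (to (connected⇒walk es c)))
                       (λ c → walk⇒connected es (from (connected⇒walk es′ c)))

  walk-[] : ∀ {n} {a b : Fin n} → Walk [] a b → a ≡ b
  walk-[] ε             = refl
  walk-[] (_ ▸ inj₁ ())
  walk-[] (_ ▸ inj₂ ())

  b₀-[] : ∀ n → b₀ {n} [] ≡ n
  b₀-[] n = trans (b₀≡#classes {n} []) (#classes-≡ (connected-isEquivalence {n} []) (record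
    { cls        = λ x → x
    ; sound      = λ c → walk-[] (connected⇒walk [] c)
    ; exact      = λ { refl → walk⇒connected {n} [] ε }
    ; surjective = λ y → y , refl
    }))

  b₀≤n : ∀ {n} (es : Edges n) → b₀ es ≤ n
  b₀≤n es rewrite b₀≡#classes es = #true≤n _

  module AddEdge {n} (s : Edges n) (u v : Fin n) where

    Near : Fin n → Set
    Near x = Walk s x u ⊎ Walk s x v

    Near-step : ∀ {c d} → Near c → Adjacent s c d → Near d
    Near-step (inj₁ p) e = inj₁ (walk-trans (walk-edge (Adjacent-sym e)) p)
    Near-step (inj₂ p) e = inj₂ (walk-trans (walk-edge (Adjacent-sym e)) p)

    -- A walk using the new edge uv passes through u or v, so both its ends are near uv.
    walk-split : ∀ {a b} → Walk ((u , v) ∷ s) a b → Walk s a b ⊎ (Near a × Near b)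
    walk-split ε = inj₁ ε
    walk-split (p ▸ inj₁ (here refl)) with walk-split p
    ... | inj₁ q        = inj₂ (inj₁ q , inj₂ ε)
    ... | inj₂ (na , _) = inj₂ (na , inj₂ ε)
    walk-split (p ▸ inj₂ (here refl)) with walk-split p
    ... | inj₁ q        = inj₂ (inj₂ q , inj₁ ε)
    ... | inj₂ (na , _) = inj₂ (na , inj₁ ε)
    walk-split (p ▸ inj₁ (there e∈s)) with walk-split p
    ... | inj₁ q         = inj₁ (q ▸ inj₁ e∈s)
    ... | inj₂ (na , nb) = inj₂ (na , Near-step nb (inj₁ e∈s))
    walk-split (p ▸ inj₂ (there e∈s)) with walk-split p
    ... | inj₁ q         = inj₁ (q ▸ inj₂ e∈s)
    ... | inj₂ (na , nb) = inj₂ (na , Near-step nb (inj₂ e∈s))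

    lift : ∀ {a b} → Walk s a b → Walk ((u , v) ∷ s) a b
    lift = walk-mono there

    uv : Walk ((u , v) ∷ s) u v
    uv = walk-edge (inj₁ (here refl))

    near⇒walk-u : ∀ {a} → Near a → Walk ((u , v) ∷ s) a u
    near⇒walk-u (inj₁ p) = lift p
    near⇒walk-u (inj₂ p) = walk-trans (lift p) (walk-sym uv)

    walk-join : ∀ {a b} → Walk s a b ⊎ (Near a × Near b) → Walk ((u , v) ∷ s) a b
    walk-join (inj₁ p)         = lift p
    walk-join (inj₂ (na , nb)) = walk-trans (near⇒walk-u na) (walk-sym (near⇒walk-u nb))

    b₀-∷-connected : connected s u v ≡ true → b₀ ((u , v) ∷ s) ≡ b₀ s
    b₀-∷-connected c = b₀-resp-walks _ _ (drop-uv ∘ walk-split) lift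
      where
      u↝v = connected⇒walk s c
      near⇒walk : ∀ {a} → Near a → Walk s a u
      near⇒walk (inj₁ p) = p
      near⇒walk (inj₂ p) = walk-trans p (walk-sym u↝v)
      drop-uv : ∀ {a b} → Walk s a b ⊎ (Near a × Near b) → Walk s a b
      drop-uv (inj₁ p)         = p
      drop-uv (inj₂ (na , nb)) = walk-trans (near⇒walk na) (walk-sym (near⇒walk nb))

    b₀-∷-isthmus : connected s u v ≡ false → suc (b₀ ((u , v) ∷ s)) ≡ b₀ s
    b₀-∷-isthmus c = begin
      suc (b₀ ((u , v) ∷ s))                   ≡⟨ cong suc (b₀≡#classes ((u , v) ∷ s)) ⟩
      suc (#classes (connected ((u , v) ∷ s))) ≡⟨ #classes-merge merged⇒ ⇒merged ⟩
      #classes (connected s)                   ≡⟨ b₀≡#classes s ⟨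
      b₀ s                                     ∎
      where
      open ≡-Reasoning
      open Merge (connected-isEquivalence s) (connected-isEquivalence ((u , v) ∷ s)) c
        using (Merged; #classes-merge) renaming (Near to NearInClasses)
      toNear : ∀ {a} → Near a → NearInClasses a
      toNear (inj₁ p) = inj₁ (walk⇒connected s p)
      toNear (inj₂ p) = inj₂ (walk⇒connected s p)
      fromNear : ∀ {a} → NearInClasses a → Near a
      fromNear (inj₁ r) = inj₁ (connected⇒walk s r)
      fromNear (inj₂ r) = inj₂ (connected⇒walk s r)
      merged⇒ : ∀ {a b} → connected ((u , v) ∷ s) a b ≡ true → Merged a b
      merged⇒ r with walk-split (connected⇒walk _ r)
      ... | inj₁ p         = inj₁ (walk⇒connected s p)
      ... | inj₂ (na , nb) = inj₂ (toNear na , toNear nb)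
      ⇒merged : ∀ {a b} → Merged a b → connected ((u , v) ∷ s) a b ≡ true
      ⇒merged (inj₁ r)         = walk⇒connected _ (walk-join (inj₁ (connected⇒walk s r)))
      ⇒merged (inj₂ (na , nb)) = walk⇒connected _ (walk-join (inj₂ (fromNear na , fromNear nb)))

  open AddEdge public using (b₀-∷-connected; b₀-∷-isthmus)

  n≤|s|+b₀ : ∀ {n} (s : Edges n) → n ≤ length s ℕ.+ b₀ s
  n≤|s|+b₀ {n} [] rewrite b₀-[] n = ℕP.≤-refl
  n≤|s|+b₀ {n} ((u , v) ∷ s) with connected s u v in c
  ... | true rewrite b₀-∷-connected s u v c = ℕP.≤-trans (n≤|s|+b₀ s) (ℕP.n≤1+n _)
  ... | false = ℕP.≤-trans (n≤|s|+b₀ s)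
                  (ℕP.≤-reflexive (trans (cong (length s ℕ.+_) (sym (b₀-∷-isthmus s u v c))) (ℕP.+-suc (length s) _)))

  module ContractEdge {m} (s : Edges (suc m)) (u v : Fin (suc m)) (u≢v : u ≢ v) where

    open VertexContraction u v u≢v

    private
      c  = contractV u v u≢v
      cs = contractE u v u≢v s
      es = (u , v) ∷ s

    walk-contract : ∀ {a b} → Walk es a b → Walk cs (c a) (c b)
    walk-contract ε = ε
    walk-contract {a} (p ▸ inj₁ (here refl)) = subst (Walk cs (c a)) contractV-identifies (walk-contract p)
    walk-contract {a} (p ▸ inj₂ (here refl)) = subst (Walk cs (c a)) (sym contractV-identifies) (walk-contract p)
    walk-contract (p ▸ inj₁ (there e∈s)) = walk-contract p ▸ inj₁ (∈-map⁺ _ e∈s)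
    walk-contract (p ▸ inj₂ (there e∈s)) = walk-contract p ▸ inj₂ (∈-map⁺ _ e∈s)

    endpoint⇒walk-u : ∀ {a} → Endpoint a → Walk es a u
    endpoint⇒walk-u (inj₁ refl) = ε
    endpoint⇒walk-u (inj₂ refl) = walk-sym (AddEdge.uv s u v)

    same-image⇒walk : ∀ a b → c a ≡ c b → Walk es a b
    same-image⇒walk a b ca≡cb with contractV-fibre a b ca≡cb
    ... | inj₁ refl       = ε
    ... | inj₂ (ea , eb)  = walk-trans (endpoint⇒walk-u ea) (walk-sym (endpoint⇒walk-u eb))

    walk-expand : ∀ {x y} → Walk cs x y → ∀ a b → c a ≡ x → c b ≡ y → Walk es a b
    walk-expand ε a b ca cb = same-image⇒walk a b (trans ca (sym cb))
    walk-expand (p ▸ inj₁ e∈cs) a b ca cb with ∈-map⁻ _ e∈cs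
    ... | (x , y) , xy∈s , refl =
      walk-trans (walk-expand p a x ca refl ▸ inj₁ (there xy∈s)) (same-image⇒walk y b (sym cb))
    walk-expand (p ▸ inj₂ e∈cs) a b ca cb with ∈-map⁻ _ e∈cs
    ... | (x , y) , xy∈s , refl =
      walk-trans (walk-expand p a y ca refl ▸ inj₂ (there xy∈s)) (same-image⇒walk x b (sym cb))

    b₀-contract : b₀ es ≡ b₀ cs
    b₀-contract = begin
      b₀ es                                          ≡⟨ b₀≡#classes es ⟩
      #classes (connected es)                        ≡⟨ #classes-deleteVertex (connected es) (connected-isEquivalence es)
                                                          (walk⇒connected es (AddEdge.uv s u v)) u≢v ⟨
      #classes (deleteVertex v (connected es))       ≡⟨ #classes-cong _ _ same ⟩
      #classes (connected cs)                        ≡⟨ b₀≡#classes cs ⟨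
      b₀ cs                                          ∎
      where
      open ≡-Reasoning
      same : ∀ y z → connected es (punchIn v y) (punchIn v z) ≡ connected cs y z
      same y z = ⇔true⇒≡
        (λ r → walk⇒connected cs (subst₂ (Walk cs) (contractV-punchIn y) (contractV-punchIn z)
                                   (walk-contract (connected⇒walk es r))))
        (λ r → walk⇒connected es (walk-expand (connected⇒walk cs r) _ _ (contractV-punchIn y) (contractV-punchIn z)))

  open ContractEdge public using (b₀-contract)

  ∈-subsets⇒⊆ : ∀ {A : Set} (es : List A) {s x} → s ∈ subsets es → x ∈ s → x ∈ es
  ∈-subsets⇒⊆ []       (here refl) ()
  ∈-subsets⇒⊆ (e ∷ es) {s} s∈ x∈s with ∈-++⁻ (subsets es) s∈
  ... | inj₁ s∈rest = there (∈-subsets⇒⊆ es s∈rest x∈s)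
  ... | inj₂ s∈e∷rest with ∈-map⁻ _ s∈e∷rest
  ...   | s′ , s′∈ , refl with x∈s
  ...     | here refl  = here refl
  ...     | there x∈s′ = there (∈-subsets⇒⊆ es s′∈ x∈s′)

  disconnected-subset : ∀ {n} (es : Edges n) {s} u v → s ∈ subsets es →
                        connected es u v ≡ false → connected s u v ≡ false
  disconnected-subset es {s} u v s∈ disconnected with connected s u v in c
  ... | false = refl
  ... | true  = trans (sym (walk⇒connected es (walk-mono (∈-subsets⇒⊆ es s∈) (connected⇒walk s c)))) disconnected

module TutteHatRecurrence where

  open Polynomials
  open Signs
  open Walks using (walk⇒connected; ε)
  open Components

  sumP-++ : ∀ xs ys → sumP (xs ++ ys) ≈P (sumP xs +P sumP ys)
  sumP-++ []       ys = ≈P-sym (+P-identityˡ (sumP ys))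
  sumP-++ (x ∷ xs) ys = ≈P-trans (+P-cong {x} ≈P-refl (sumP-++ xs ys)) (≈P-sym (+P-assoc x (sumP xs) (sumP ys)))

  sumP-cong : ∀ {A : Set} (xs : List A) {f g : A → Poly} → (∀ x → x ∈ xs → f x ≈P g x) →
              sumP (map f xs) ≈P sumP (map g xs)
  sumP-cong []       f≈g = ≈P-refl
  sumP-cong (x ∷ xs) f≈g = +P-cong (f≈g x (here refl)) (sumP-cong xs (λ y y∈ → f≈g y (there y∈)))

  sumP-· : ∀ {A : Set} c (f : A → Poly) xs → sumP (map (λ x → c · f x) xs) ≈P (c · sumP (map f xs))
  sumP-· c f []       i j = sym (ℤP.*-zeroʳ c)
  sumP-· c f (x ∷ xs) = ≈P-trans (+P-cong {c · f x} ≈P-refl (sumP-· c f xs)) (≈P-sym (·-distrib-+P c (f x) (sumP (map f xs))))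

  sumP-*P : ∀ {A : Set} p (f : A → Poly) xs → sumP (map (λ x → p *P f x) xs) ≈P (p *P sumP (map f xs))
  sumP-*P p f []       = ≈P-sym (*P-zeroʳ p)
  sumP-*P p f (x ∷ xs) =
    ≈P-trans (+P-cong {p *P f x} ≈P-refl (sumP-*P p f xs)) (≈P-sym (*P-distribˡ-+P p (f x) (sumP (map f xs))))

  subsets-map : ∀ {A B : Set} (f : A → B) (es : List A) → subsets (map f es) ≡ map (map f) (subsets es)
  subsets-map f []       = refl
  subsets-map f (e ∷ es) rewrite subsets-map f es = sym (begin
    map (map f) (subsets es ++ map (e ∷_) (subsets es))
      ≡⟨ ListP.map-++ (map f) (subsets es) _ ⟩
    map (map f) (subsets es) ++ map (map f) (map (e ∷_) (subsets es))
      ≡⟨ cong (map (map f) (subsets es) ++_) (sym (ListP.map-∘ (subsets es))) ⟩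
    map (map f) (subsets es) ++ map (map f ∘ (e ∷_)) (subsets es)
      ≡⟨ cong (map (map f) (subsets es) ++_) (ListP.map-∘ (subsets es)) ⟩
    map (map f) (subsets es) ++ map (f e ∷_) (map (map f) (subsets es)) ∎)
    where open ≡-Reasoning

  weight : ℕ → ℕ → ℕ → Poly
  weight l a b = constP (sign l) *P (((1P +P X) ^P a) *P ((1P +P Y) ^P b))

  term : ∀ n → Edges n → Poly
  term n s = weight (length s) (b₀ s) (b₁ s)

  T̂ : ∀ n → Edges n → Poly
  T̂ n es = sumP (map (term n) (subsets es))

  weight-≡ : ∀ {l l′ a a′ b b′} → l ≡ l′ → a ≡ a′ → b ≡ b′ → weight l a b ≡ weight l′ a′ b′
  weight-≡ refl refl refl = refl

  weight-suc : ∀ l a b → weight (suc l) a b ≈P (ℤ.-1ℤ · weight l a b)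
  weight-suc l a b = begin
    weight (suc l) a b                     ≈⟨ constP-*P (sign (suc l)) _ ⟩
    sign (suc l) · W                       ≈⟨ ·-assoc ℤ.-1ℤ (sign l) W ⟨
    ℤ.-1ℤ · sign l · W                     ≈⟨ ·-congʳ ℤ.-1ℤ (constP-*P (sign l) W) ⟨
    ℤ.-1ℤ · weight l a b                   ∎
    where
    open ≈P-Reasoning
    W = ((1P +P X) ^P a) *P ((1P +P Y) ^P b)

  weight-suc-b₀ : ∀ l a b → weight l (suc a) b ≈P ((1P +P X) *P weight l a b)
  weight-suc-b₀ l a b = begin
    weight l (suc a) b                                           ≈⟨ constP-*P (sign l) _ ⟩
    sign l · (((1P +P X) *P ((1P +P X) ^P a)) *P ((1P +P Y) ^P b)) ≈⟨ ·-congʳ (sign l) (*P-assoc (1P +P X) ((1P +P X) ^P a) ((1P +P Y) ^P b)) ⟩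
    sign l · ((1P +P X) *P W)                                    ≈⟨ *P-·-comm (sign l) (1P +P X) W ⟨
    (1P +P X) *P (sign l · W)                                    ≈⟨ *P-congˡ (1P +P X) (constP-*P (sign l) W) ⟨
    (1P +P X) *P weight l a b                                    ∎
    where
    open ≈P-Reasoning
    W = ((1P +P X) ^P a) *P ((1P +P Y) ^P b)

  weight-suc-b₁ : ∀ l a b → weight l a (suc b) ≈P ((1P +P Y) *P weight l a b)
  weight-suc-b₁ l a b = begin
    weight l a (suc b)                                     ≈⟨ constP-*P (sign l) _ ⟩
    sign l · (((1P +P X) ^P a) *P ((1P +P Y) *P Yb))       ≈⟨ ·-congʳ (sign l) (*P-lcomm ((1P +P X) ^P a) (1P +P Y) Yb) ⟩
    sign l · ((1P +P Y) *P W)                              ≈⟨ *P-·-comm (sign l) (1P +P Y) W ⟨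
    (1P +P Y) *P (sign l · W)                              ≈⟨ *P-congˡ (1P +P Y) (constP-*P (sign l) W) ⟨
    (1P +P Y) *P weight l a b                              ∎
    where
    open ≈P-Reasoning
    Yb = (1P +P Y) ^P b
    W = ((1P +P X) ^P a) *P Yb

  T̂-∷ : ∀ n e (es : Edges n) → T̂ n (e ∷ es) ≈P (T̂ n es +P sumP (map (λ s → term n (e ∷ s)) (subsets es)))
  T̂-∷ n e es = begin
    sumP (map (term n) (subsets es ++ map (e ∷_) (subsets es)))
      ≡⟨ cong sumP (ListP.map-++ (term n) (subsets es) _) ⟩
    sumP (map (term n) (subsets es) ++ map (term n) (map (e ∷_) (subsets es)))
      ≈⟨ sumP-++ (map (term n) (subsets es)) _ ⟩
    T̂ n es +P sumP (map (term n) (map (e ∷_) (subsets es)))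
      ≡⟨ cong (λ xs → T̂ n es +P sumP xs) (sym (ListP.map-∘ (subsets es))) ⟩
    T̂ n es +P sumP (map (λ s → term n (e ∷ s)) (subsets es)) ∎
    where open ≈P-Reasoning

  T̂-loop : ∀ n (s : Edges n) u → T̂ n ((u , u) ∷ s) ≈P (ℤ.-1ℤ · (Y *P T̂ n s))
  T̂-loop n s u = begin
    T̂ n ((u , u) ∷ s)                                              ≈⟨ T̂-∷ n (u , u) s ⟩
    T̂ n s +P sumP (map (λ s′ → term n ((u , u) ∷ s′)) (subsets s)) ≈⟨ +P-cong (≈P-refl {T̂ n s}) with-loop ⟩
    T̂ n s +P ℤ.-1ℤ · ((1P +P Y) *P T̂ n s)                          ≈⟨ +P-cong (≈P-refl {T̂ n s}) (·-congʳ ℤ.-1ℤ (1+Z*P Y (T̂ n s))) ⟩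
    T̂ n s +P ℤ.-1ℤ · (T̂ n s +P (Y *P T̂ n s))                       ≈⟨ (λ i j → cancel (T̂ n s i j) ((Y *P T̂ n s) i j)) ⟩
    ℤ.-1ℤ · (Y *P T̂ n s)                                           ∎
    where
    open ≈P-Reasoning
    cancel : ∀ x y → x + ℤ.-1ℤ * (x + y) ≡ ℤ.-1ℤ * y
    cancel = solve 2 (λ x y → x :+ con ℤ.-1ℤ :* (x :+ y) := con ℤ.-1ℤ :* y) refl
      where open ℤSolver
    b₀-loop : ∀ s′ → b₀ ((u , u) ∷ s′) ≡ b₀ s′
    b₀-loop s′ = b₀-∷-connected s′ u u (walk⇒connected s′ ε)
    b₁-loop : ∀ s′ → b₁ ((u , u) ∷ s′) ≡ suc (b₁ s′)
    b₁-loop s′ = trans (cong (λ c → (suc (length s′) ℕ.+ c) ∸ n) (b₀-loop s′)) (ℕP.+-∸-assoc 1 (n≤|s|+b₀ s′))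
    term-loop : ∀ s′ → term n ((u , u) ∷ s′) ≈P (ℤ.-1ℤ · ((1P +P Y) *P term n s′))
    term-loop s′ = ≈P-trans (≡⇒≈P (weight-≡ {suc (length s′)} refl (b₀-loop s′) (b₁-loop s′)))
                     (≈P-trans (weight-suc (length s′) (b₀ s′) (suc (b₁ s′))) (·-congʳ ℤ.-1ℤ (weight-suc-b₁ (length s′) (b₀ s′) (b₁ s′))))
    with-loop : sumP (map (λ s′ → term n ((u , u) ∷ s′)) (subsets s)) ≈P (ℤ.-1ℤ · ((1P +P Y) *P T̂ n s))
    with-loop = ≈P-trans (sumP-cong (subsets s) (λ s′ _ → term-loop s′))
                  (≈P-trans (sumP-· ℤ.-1ℤ (λ s′ → (1P +P Y) *P term n s′) (subsets s))
                    (·-congʳ ℤ.-1ℤ (sumP-*P (1P +P Y) (term n) (subsets s))))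

  module _ {m} (s : Edges (suc m)) (u v : Fin (suc m)) (u≢v : u ≢ v) where

    private
      contract = contractE u v u≢v
      cs = contract s
      contract-pair : Fin (suc m) × Fin (suc m) → Fin m × Fin m
      contract-pair (a , b) = (contractV u v u≢v a , contractV u v u≢v b)

    sumP-subsets-contract : ∀ (f : Edges m → Poly) →
                            sumP (map (f ∘ contract) (subsets s)) ≡ sumP (map f (subsets cs))
    sumP-subsets-contract f =
      cong sumP (trans (ListP.map-∘ (subsets s)) (cong (map f) (sym (subsets-map contract-pair s))))

    term-contract : ∀ s′ → term m (contract s′) ≡ weight (length s′) (b₀ (contract s′)) ((length s′ ℕ.+ b₀ (contract s′)) ∸ m)
    term-contract s′ = weight-≡ {a = b₀ (contract s′)} {b = b₁ (contract s′)} (ListP.length-map contract-pair s′) refl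
                         (cong (λ l → (l ℕ.+ b₀ (contract s′)) ∸ m) (ListP.length-map contract-pair s′))

    T̂-nonloop : T̂ (suc m) ((u , v) ∷ s) ≈P (T̂ (suc m) s +P ℤ.-1ℤ · T̂ m cs)
    T̂-nonloop = ≈P-trans (T̂-∷ (suc m) (u , v) s) (+P-cong (≈P-refl {T̂ (suc m) s}) with-edge)
      where
      term-edge : ∀ s′ → term (suc m) ((u , v) ∷ s′) ≈P (ℤ.-1ℤ · term m (contract s′))
      term-edge s′ = begin
        term (suc m) ((u , v) ∷ s′)
          ≡⟨ weight-≡ {suc (length s′)} refl (b₀-contract s′ u v u≢v)
               (cong (λ c → (length s′ ℕ.+ c) ∸ m) (b₀-contract s′ u v u≢v)) ⟩
        weight (suc (length s′)) (b₀ (contract s′)) ((length s′ ℕ.+ b₀ (contract s′)) ∸ m)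
          ≈⟨ weight-suc (length s′) (b₀ (contract s′)) ((length s′ ℕ.+ b₀ (contract s′)) ∸ m) ⟩
        ℤ.-1ℤ · weight (length s′) (b₀ (contract s′)) ((length s′ ℕ.+ b₀ (contract s′)) ∸ m)
          ≡⟨ cong (ℤ.-1ℤ ·_) (sym (term-contract s′)) ⟩
        ℤ.-1ℤ · term m (contract s′) ∎
        where open ≈P-Reasoning
      with-edge : sumP (map (λ s′ → term (suc m) ((u , v) ∷ s′)) (subsets s)) ≈P (ℤ.-1ℤ · T̂ m cs)
      with-edge = ≈P-trans (sumP-cong (subsets s) (λ s′ _ → term-edge s′))
                    (≈P-trans (sumP-· ℤ.-1ℤ (term m ∘ contract) (subsets s))
                      (·-congʳ ℤ.-1ℤ (≡⇒≈P (sumP-subsets-contract (term m)))))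

    -- No spanning subgraph of G - uv joins u and v, so contracting uv merges two of its components.
    T̂-isthmus : connected s u v ≡ false → T̂ (suc m) s ≈P ((1P +P X) *P T̂ m cs)
    T̂-isthmus disconnected =
      ≈P-trans (sumP-cong (subsets s) term-isthmus)
        (≈P-trans (sumP-*P (1P +P X) (term m ∘ contract) (subsets s))
          (*P-congˡ (1P +P X) (≡⇒≈P (sumP-subsets-contract (term m)))))
      where
      b₀-split : ∀ s′ → s′ ∈ subsets s → b₀ s′ ≡ suc (b₀ (contract s′))
      b₀-split s′ s′⊆s = trans (sym (b₀-∷-isthmus s′ u v (disconnected-subset s u v s′⊆s disconnected)))
                               (cong suc (b₀-contract s′ u v u≢v))
      term-isthmus : ∀ s′ → s′ ∈ subsets s → term (suc m) s′ ≈P ((1P +P X) *P term m (contract s′))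
      term-isthmus s′ s′⊆s = begin
        term (suc m) s′
          ≡⟨ weight-≡ {length s′} refl (b₀-split s′ s′⊆s)
               (trans (cong (λ c → (length s′ ℕ.+ c) ∸ suc m) (b₀-split s′ s′⊆s))
                      (cong (_∸ suc m) (ℕP.+-suc (length s′) _))) ⟩
        weight (length s′) (suc (b₀ (contract s′))) ((length s′ ℕ.+ b₀ (contract s′)) ∸ m)
          ≈⟨ weight-suc-b₀ (length s′) (b₀ (contract s′)) ((length s′ ℕ.+ b₀ (contract s′)) ∸ m) ⟩
        (1P +P X) *P weight (length s′) (b₀ (contract s′)) ((length s′ ℕ.+ b₀ (contract s′)) ∸ m)
          ≡⟨ cong ((1P +P X) *P_) (sym (term-contract s′)) ⟩
        (1P +P X) *P term m (contract s′) ∎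
        where open ≈P-Reasoning

module KeyIdentity where

  open Polynomials
  open Signs
  open NegatedVariables
  open TwistInjectivity
  open Twisting
  open Walks using (walk⇒connected; ε)
  open Components
  open TutteHatRecurrence

  Tutte : ∀ n → Edges n → Poly
  Tutte n es = tutteAux (length es) n es

  data TutteStep {m} (u v : Fin (suc m)) (s : Edges (suc m)) : Set where
    loop     : u ≡ v → Tutte (suc m) ((u , v) ∷ s) ≡ (Y *P Tutte (suc m) s) → TutteStep u v s
    ordinary : (u≢v : u ≢ v) → connected s u v ≡ true →
               Tutte (suc m) ((u , v) ∷ s) ≡ (Tutte (suc m) s +P Tutte m (contractE u v u≢v s)) → TutteStep u v s
    isthmus  : u ≢ v → connected s u v ≡ false →
               Tutte (suc m) ((u , v) ∷ s) ≡ (X *P Tutte (suc m) s) → TutteStep u v s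

  tutteStep : ∀ {m} u v (s : Edges (suc m)) → TutteStep u v s
  tutteStep {m} u v s with u ≟ v in u≟v
  ... | yes u≡v = loop u≡v by-loop
    where
    by-loop : Tutte (suc m) ((u , v) ∷ s) ≡ (Y *P Tutte (suc m) s)
    by-loop rewrite u≟v = refl
  ... | no u≢v with connected s u v in c
  ...   | true  = ordinary u≢v c by-deletion-contraction
    where
    by-deletion-contraction : Tutte (suc m) ((u , v) ∷ s) ≡ (Tutte (suc m) s +P Tutte m (contractE u v u≢v s))
    by-deletion-contraction rewrite u≟v | c =
      cong (λ k → Tutte (suc m) s +P tutteAux k m (contractE u v u≢v s)) (sym (ListP.length-map _ s))
  ...   | false = isthmus u≢v c by-isthmus
    where
    by-isthmus : Tutte (suc m) ((u , v) ∷ s) ≡ (X *P Tutte (suc m) s)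
    by-isthmus rewrite u≟v | c = refl

  tutteAux-NonzeroℕPoly : ∀ k n (es : Edges n) → NonzeroℕPoly (tutteAux k n es)
  tutteAux-NonzeroℕPoly k       n       []             = NonzeroℕPoly-1P
  tutteAux-NonzeroℕPoly zero    n       (_ ∷ _)        = NonzeroℕPoly-1P
  tutteAux-NonzeroℕPoly (suc k) zero    ((() , _) ∷ _)
  tutteAux-NonzeroℕPoly (suc k) (suc m) ((u , v) ∷ es) with u ≟ v
  ... | yes _ = NonzeroℕPoly-Y*P (tutteAux-NonzeroℕPoly k (suc m) es)
  ... | no u≢v with connected es u v
  ...   | true  = NonzeroℕPoly-+P (tutteAux-NonzeroℕPoly k (suc m) es) (tutteAux-NonzeroℕPoly k m (contractE u v u≢v es))
  ...   | false = NonzeroℕPoly-X*P (tutteAux-NonzeroℕPoly k (suc m) es)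

  Twisted : ∀ n → Edges n → Set
  Twisted n es = T̂ n es ≈P twist (n ∸ b₀ es) (b₀ es) (Tutte n es)

  twisted-[] : ∀ n → Twisted n []
  twisted-[] n = begin
    term n [] +P 0P                                   ≈⟨ +P-identityʳ (term n []) ⟩
    weight 0 (b₀ {n} []) (b₁ {n} [])                  ≡⟨ weight-≡ {0} refl (b₀-[] n) b₁-[] ⟩
    weight 0 n 0                                      ≈⟨ constP-*P (+ 1) (P^n *P 1P) ⟩
    (+ 1) · (P^n *P 1P)                               ≈⟨ ·-congʳ (+ 1) (*P-congˡ P^n negVars-1P) ⟨
    twist 0 n 1P                                      ≡⟨ cong₂ (λ e k → twist e k 1P) (sym n∸b₀≡0) (sym (b₀-[] n)) ⟩
    twist (n ∸ b₀ {n} []) (b₀ {n} []) 1P              ∎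
    where
    open ≈P-Reasoning
    P^n = (1P +P X) ^P n
    n∸b₀≡0 : n ∸ b₀ {n} [] ≡ 0
    n∸b₀≡0 = trans (cong (n ∸_) (b₀-[] n)) (ℕP.n∸n≡0 n)
    b₁-[] : b₁ {n} [] ≡ 0
    b₁-[] = trans (cong (_∸ n) (b₀-[] n)) (ℕP.n∸n≡0 n)

  twisted-loop : ∀ {m} (s : Edges (suc m)) u →
                 Tutte (suc m) ((u , u) ∷ s) ≡ (Y *P Tutte (suc m) s) → Twisted (suc m) s → Twisted (suc m) ((u , u) ∷ s)
  twisted-loop {m} s u step ih rewrite b₀-∷-connected s u u (walk⇒connected s ε) | step = begin
    T̂ (suc m) ((u , u) ∷ s)                      ≈⟨ T̂-loop (suc m) s u ⟩
    ℤ.-1ℤ · (Y *P T̂ (suc m) s)                   ≈⟨ ·-congʳ ℤ.-1ℤ (*P-congˡ Y ih) ⟩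
    ℤ.-1ℤ · (Y *P twist e (b₀ s) (Tutte _ s))    ≈⟨ twist-Y e (b₀ s) (Tutte _ s) ⟨
    twist e (b₀ s) (Y *P Tutte _ s)              ∎
    where
    open ≈P-Reasoning
    e = suc m ∸ b₀ s

  module _ {m} (s : Edges (suc m)) (u v : Fin (suc m)) (u≢v : u ≢ v) where

    private
      cs = contractE u v u≢v s
      k  = b₀ ((u , v) ∷ s)
      b₀-cs : b₀ cs ≡ k
      b₀-cs = sym (b₀-contract s u v u≢v)
      k≤m : k ≤ m
      k≤m = subst (_≤ m) b₀-cs (b₀≤n cs)
      suc-m∸k : suc m ∸ k ≡ suc (m ∸ k)
      suc-m∸k = ℕP.+-∸-assoc 1 k≤m

    twisted-ordinary : connected s u v ≡ true →
                       Tutte (suc m) ((u , v) ∷ s) ≡ (Tutte (suc m) s +P Tutte m cs) →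
                       Twisted (suc m) s → Twisted m cs → Twisted (suc m) ((u , v) ∷ s)
    twisted-ordinary c step ih ih-cs = begin
      T̂ (suc m) ((u , v) ∷ s)                                          ≈⟨ T̂-nonloop s u v u≢v ⟩
      T̂ (suc m) s +P ℤ.-1ℤ · T̂ m cs                                    ≈⟨ +P-cong ih (·-congʳ ℤ.-1ℤ ih-cs) ⟩
      twist (suc m ∸ b₀ s) (b₀ s) Ts +P ℤ.-1ℤ · twist (m ∸ b₀ cs) (b₀ cs) Tcs
        ≡⟨ cong₂ (λ a b → twist (suc m ∸ a) a Ts +P ℤ.-1ℤ · twist (m ∸ b) b Tcs) b₀-s b₀-cs ⟩
      twist (suc m ∸ k) k Ts +P ℤ.-1ℤ · twist (m ∸ k) k Tcs
        ≡⟨ cong (λ e → twist e k Ts +P ℤ.-1ℤ · twist (m ∸ k) k Tcs) suc-m∸k ⟩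
      twist (suc (m ∸ k)) k Ts +P ℤ.-1ℤ · twist (m ∸ k) k Tcs           ≈⟨ +P-cong (≈P-refl {twist (suc (m ∸ k)) k Ts}) (twist-suc (m ∸ k) k Tcs) ⟨
      twist (suc (m ∸ k)) k Ts +P twist (suc (m ∸ k)) k Tcs              ≈⟨ twist-+P (suc (m ∸ k)) k Ts Tcs ⟨
      twist (suc (m ∸ k)) k (Ts +P Tcs)                                  ≡⟨ cong₂ (λ e T → twist e k T) (sym suc-m∸k) (sym step) ⟩
      twist (suc m ∸ k) k (Tutte (suc m) ((u , v) ∷ s))                  ∎
      where
      open ≈P-Reasoning
      Ts = Tutte (suc m) s
      Tcs = Tutte m cs
      b₀-s : b₀ s ≡ k
      b₀-s = sym (b₀-∷-connected s u v c)

    -- Deleting an isthmus splits a component, so T̂(G - e) carries one extra factor 1 + x, which cancels.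
    twisted-isthmus : connected s u v ≡ false →
                      Tutte (suc m) ((u , v) ∷ s) ≡ (X *P Tutte (suc m) s) →
                      Twisted (suc m) s → Twisted (suc m) ((u , v) ∷ s)
    twisted-isthmus c step ih = begin
      T̂ (suc m) ((u , v) ∷ s)                  ≈⟨ T̂-nonloop s u v u≢v ⟩
      T̂ (suc m) s +P ℤ.-1ℤ · T̂ m cs            ≈⟨ +P-cong T̂-s (·-congʳ ℤ.-1ℤ T̂-cs) ⟩
      ((1P +P X) *P Q) +P ℤ.-1ℤ · Q            ≈⟨ +P-cong (1+Z*P X Q) (≈P-refl {ℤ.-1ℤ · Q}) ⟩
      (Q +P (X *P Q)) +P ℤ.-1ℤ · Q             ≈⟨ (λ i j → cancel (Q i j) ((X *P Q) i j)) ⟩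
      X *P Q                                   ≈⟨ twist-X (m ∸ k) k Ts ⟨
      twist (suc (m ∸ k)) k (X *P Ts)          ≡⟨ cong₂ (λ e T → twist e k T) (sym suc-m∸k) (sym step) ⟩
      twist (suc m ∸ k) k (Tutte (suc m) ((u , v) ∷ s)) ∎
      where
      open ≈P-Reasoning
      Ts = Tutte (suc m) s
      Q = twist (m ∸ k) k Ts
      cancel : ∀ q xq → (q + xq) + ℤ.-1ℤ * q ≡ xq
      cancel = solve 2 (λ q xq → (q :+ xq) :+ con ℤ.-1ℤ :* q := xq) refl
        where open ℤSolver
      T̂-s : T̂ (suc m) s ≈P ((1P +P X) *P Q)
      T̂-s = ≈P-trans ih (≈P-trans (≡⇒≈P (cong (λ a → twist (suc m ∸ a) a Ts) (sym (b₀-∷-isthmus s u v c))))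
                                  (twist-[1+X] (m ∸ k) k Ts))
      T̂-cs : T̂ m cs ≈P Q
      T̂-cs = 1+X*P-cancel (T̂ m cs) Q (≈P-trans (≈P-sym (T̂-isthmus s u v u≢v c)) T̂-s)

  twisted : ∀ l n (es : Edges n) → length es ≡ l → Twisted n es
  twisted l       n       []             _ = twisted-[] n
  twisted zero    n       (_ ∷ _)        ()
  twisted (suc l) zero    ((() , _) ∷ s) _
  twisted (suc l) (suc m) ((u , v) ∷ s)  |s|≡l with tutteStep u v s
  ... | loop refl step = twisted-loop s u step (twisted l (suc m) s (ℕP.suc-injective |s|≡l))
  ... | ordinary u≢v c step =
    twisted-ordinary s u v u≢v c step (twisted l (suc m) s (ℕP.suc-injective |s|≡l))
      (twisted l m (contractE u v u≢v s) (trans (ListP.length-map _ s) (ℕP.suc-injective |s|≡l)))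
  ... | isthmus u≢v c step = twisted-isthmus s u v u≢v c step (twisted l (suc m) s (ℕP.suc-injective |s|≡l))

open Polynomials using (≈P-sym; ≈P-trans)
open TwistInjectivity using (twist-injective)
open KeyIdentity using (twisted; tutteAux-NonzeroℕPoly)

lemma2p2 : (G G' : Graph) → That G ≈P That G' → tutte G ≈P tutte G'
lemma2p2 (graph n es) (graph n′ es′) T̂≈T̂′ =
  twist-injective (n ∸ b₀ es) (n′ ∸ b₀ es′) (b₀ es) (b₀ es′)
    (tutteAux-NonzeroℕPoly _ n es) (tutteAux-NonzeroℕPoly _ n′ es′)
    (≈P-trans (≈P-sym (twisted _ n es refl)) (≈P-trans T̂≈T̂′ (twisted _ n′ es′ refl)))
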